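{- Let $n>1$ be a positive odd integer. Then \[ \sum_{k=0}^{(n-1)/2}[4k+1]\frac{(q^{ -1};q^2)_k\, (q;q^2)_k^3} {(q^4;q^2)_k\, (q^2;q^2)_k^3}\, q^{2k} \equiv 0 \pmod{[n]^3}. \]
   Context: Here $q$ is an indeterminate. For $x$ and a base $p$ (a power of $q$), $(x;p)_k=\prod_{j=0}^{k-1}(1-xp^j)$ for integers $k\ge0$. The $q$-integer is $[j]=1+q+\cdots+q^{j-1}$. For rational functions $A(q),B(q)$ and a polynomial $P(q)$, $A\equiv B\pmod{P}$ means that the numerator of the reduced form of $A-B$ is divisible by $P$ in $\mathbb{Z}[q]$. -}

module Defs where

open import Data.Nat as ℕ using (ℕ; zero; suc)
open import Data.Integer as ℤ using (ℤ; +_; -[1+_])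
open import Data.List using (List; []; _∷_)
open import Data.Product using (Σ; _×_; _,_; proj₁; proj₂)
open import Data.Sum using (_⊎_)
open import Relation.Binary.PropositionalEquality using (_≡_)
open import Relation.Nullary using (¬_)

-- Polynomials in ℤ[q], as coefficient lists (constant term first).
-- Representations are not normalised; equality is coefficientwise.

Poly : Set
Poly = List ℤ

coeff : Poly → ℕ → ℤ
coeff []       _       = + 0
coeff (a ∷ p)  zero    = a
coeff (a ∷ p)  (suc i) = coeff p i

infix 4 _≈ₚ_
_≈ₚ_ : Poly → Poly → Set
p ≈ₚ r = ∀ i → coeff p i ≡ coeff r i

0ₚ 1ₚ qₚ : Poly
0ₚ = []
1ₚ = + 1 ∷ []
qₚ = + 0 ∷ + 1 ∷ []

infixl 6 _+ₚ_ _-ₚ_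
infixl 7 _*ₚ_ _·ₚ_

_+ₚ_ : Poly → Poly → Poly
[]      +ₚ r       = r
(a ∷ p) +ₚ []      = a ∷ p
(a ∷ p) +ₚ (b ∷ r) = (a ℤ.+ b) ∷ (p +ₚ r)

_·ₚ_ : ℤ → Poly → Poly
c ·ₚ []      = []
c ·ₚ (a ∷ p) = (c ℤ.* a) ∷ (c ·ₚ p)

negₚ : Poly → Poly
negₚ p = ℤ.- (+ 1) ·ₚ p

_-ₚ_ : Poly → Poly → Poly
p -ₚ r = p +ₚ negₚ r

_*ₚ_ : Poly → Poly → Poly
[]      *ₚ r = []
(a ∷ p) *ₚ r = (a ·ₚ r) +ₚ (+ 0 ∷ (p *ₚ r))

_^ₚ_ : Poly → ℕ → Poly
p ^ₚ zero  = 1ₚ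
p ^ₚ suc k = p *ₚ (p ^ₚ k)

infix 4 _∣ₚ_
_∣ₚ_ : Poly → Poly → Set
d ∣ₚ p = Σ Poly λ m → p ≈ₚ d *ₚ m

IsUnit : Poly → Set
IsUnit u = (u ≈ₚ 1ₚ) ⊎ (u ≈ₚ negₚ 1ₚ)

CoprimeP : Poly → Poly → Set
CoprimeP N D = ∀ g → g ∣ₚ N → g ∣ₚ D → IsUnit g

-- Rational functions in q over ℤ, as (numerator , denominator).

Frac : Set
Frac = Poly × Poly

num den : Frac → Poly
num = proj₁
den = proj₂

poly : Poly → Frac
poly p = p , 1ₚ

1f : Frac
1f = poly 1ₚ

0f : Frac
0f = poly 0ₚ

infixl 6 _+f_
infixl 7 _*f_
_+f_ : Frac → Frac → Frac
(a , b) +f (c , d) = (a *ₚ d +ₚ c *ₚ b) , (b *ₚ d)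

_*f_ : Frac → Frac → Frac
(a , b) *f (c , d) = (a *ₚ c) , (b *ₚ d)

1-f : Frac → Frac
1-f (a , b) = (b -ₚ a) , b

_^f_ : Frac → ℕ → Frac
x ^f zero  = 1f
x ^f suc k = x *f (x ^f k)

qf q⁻¹f : Frac
qf   = poly qₚ
q⁻¹f = 1ₚ , qₚ

q^ : ℕ → Frac
q^ j = qf ^f j

poch : Frac → Frac → ℕ → Frac
poch x p zero    = 1f
poch x p (suc k) = poch x p k *f 1-f (x *f (p ^f k))

qint : ℕ → Poly
qint zero    = 0ₚ
qint (suc j) = 1ₚ +ₚ (qₚ *ₚ qint j)

sumf : (ℕ → Frac) → ℕ → Frac
sumf f zero    = f zero
sumf f (suc m) = sumf f m +f f (suc m)

summand : ℕ → Frac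
summand k =
  ((((poly (qint (4 ℕ.* k ℕ.+ 1)) *f poch q⁻¹f (q^ 2) k) *f (poch qf (q^ 2) k ^f 3))
     *f q^ (2 ℕ.* k))
  *f ((den D , num D)))
  where
    D : Frac
    D = poch (q^ 4) (q^ 2) k *f (poch (q^ 2) (q^ 2) k ^f 3)

-- Congruence A ≡ 0 (mod P): the numerator of (any) reduced form of A
-- is divisible by P in ℤ[q].

IsReducedForm : Poly → Poly → Frac → Set
IsReducedForm N D A = (¬ (D ≈ₚ 0ₚ)) × CoprimeP N D × (N *ₚ den A ≈ₚ num A *ₚ D)

_≡0-mod_ : Frac → Poly → Set
A ≡0-mod P = ∀ N D → IsReducedForm N D A → P ∣ₚ N

-- The partial sums telescope (induction on m, driven by a polynomial identity
-- in q and X = q^{2m}) to the closed form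
--   S_m = (q³;q²)_m³ (q;q²)_m / ((q²;q²)_m³ (q⁴;q²)_m).
-- Since (q³;q²)_m = (q;q²)_m [n], the numerator contains [n]³.  The Pochhammer
-- identities (q;q²)_m (-q;q)_m² = [2m choose m] (q²;q²)_m and
-- (1+q)(q⁴;q²)_m = (q²;q²)_m [n+1] clear the denominator: S_m V = [n]³ U for
-- polynomials U and V = (-q;q)_m⁸ [n+1].  Modulo [n] every factor 1 + q^j of
-- (-q;q)_m divides 2 (as n is odd) and [n+1] ≡ 1, so V divides a power of 2
-- modulo [n], and modulo [n]³ after cubing.  Hence [n]³ divides 2^K times any
-- numerator of S_m, and as [n]³ has constant term 1 the power of 2 cancels.

module Submission where

open import Defs
open import Data.Nat using (ℕ; _+_; _*_; _<_)
open import Relation.Binary.PropositionalEquality using (_≡_; refl)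

open import Data.Nat using (zero; suc)
import Data.Nat.Properties as ℕP
open import Data.Integer as ℤ using (ℤ; +_)
import Data.Integer.Properties as ℤP
import Data.Integer.Tactic.RingSolver as ℤSolver
open import Data.List using ([]; _∷_)
open import Data.Product using (Σ; _,_; proj₁; proj₂)
open import Data.Sum using (inj₁; inj₂)
open import Data.Empty using (⊥-elim)
open import Data.Maybe as Maybe using (Maybe; just; nothing)
open import Relation.Nullary using (¬_; yes; no)
open import Relation.Binary.PropositionalEquality as ≡ using (_≢_; cong; cong₂)
open import Algebra.Bundles using (CommutativeRing)
open import Tactic.RingSolver.Core.AlmostCommutativeRing using (AlmostCommutativeRing; fromCommutativeRing)
open import Tactic.RingSolver using (solve-∀)

-- Coefficientwise equality wrapped in a record, so that the two polynomials
-- can be recovered from the type (a bare Π-type is not injective).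
infix 4 _≋_
record _≋_ (p r : Poly) : Set where
  constructor mk
  field get : p ≈ₚ r
open _≋_ public

coeff-+ : ∀ p r i → coeff (p +ₚ r) i ≡ coeff p i ℤ.+ coeff r i
coeff-+ []      r       i       = ≡.sym (ℤP.+-identityˡ _)
coeff-+ (a ∷ p) []      i       = ≡.sym (ℤP.+-identityʳ _)
coeff-+ (a ∷ p) (b ∷ r) zero    = refl
coeff-+ (a ∷ p) (b ∷ r) (suc i) = coeff-+ p r i

coeff-· : ∀ c p i → coeff (c ·ₚ p) i ≡ c ℤ.* coeff p i
coeff-· c []      i       = ≡.sym (ℤP.*-zeroʳ c)
coeff-· c (a ∷ p) zero    = refl
coeff-· c (a ∷ p) (suc i) = coeff-· c p i

coeff-neg : ∀ p i → coeff (negₚ p) i ≡ ℤ.- coeff p i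
coeff-neg p i = ≡.trans (coeff-· _ p i) (ℤP.-1*i≡-i (coeff p i))

sh : Poly → Poly
sh p = + 0 ∷ p

module PolyRing where

  module Additive where

    ≋-refl : ∀ {p} → p ≋ p
    ≋-refl = mk λ _ → refl

    ≋-sym : ∀ {p r} → p ≋ r → r ≋ p
    ≋-sym (mk e) = mk λ i → ≡.sym (e i)

    ≋-trans : ∀ {p r s} → p ≋ r → r ≋ s → p ≋ s
    ≋-trans (mk e) (mk f) = mk λ i → ≡.trans (e i) (f i)

    pointwise : ∀ {p r} (f g : ℕ → ℤ) → (∀ i → coeff p i ≡ f i) → (∀ i → coeff r i ≡ g i) →
                (∀ i → f i ≡ g i) → p ≋ r
    pointwise f g ep er e = mk λ i → ≡.trans (ep i) (≡.trans (e i) (≡.sym (er i)))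

    +-cong : ∀ {p p′ r r′} → p ≋ p′ → r ≋ r′ → p +ₚ r ≋ p′ +ₚ r′
    +-cong {p} {p′} {r} {r′} (mk e) (mk f) =
      pointwise _ _ (coeff-+ p r) (coeff-+ p′ r′) λ i → cong₂ ℤ._+_ (e i) (f i)

    ·-cong : ∀ c {p p′} → p ≋ p′ → c ·ₚ p ≋ c ·ₚ p′
    ·-cong c {p} {p′} (mk e) = pointwise _ _ (coeff-· c p) (coeff-· c p′) λ i → cong (c ℤ.*_) (e i)

    sh-cong : ∀ {p p′} → p ≋ p′ → sh p ≋ sh p′
    sh-cong (mk e) = mk λ { zero → refl ; (suc i) → e i }

    cons-cong : ∀ {a b p r} → a ≡ b → p ≋ r → (a ∷ p) ≋ (b ∷ r)
    cons-cong refl (mk e) = mk λ { zero → refl ; (suc i) → e i }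

    +-comm : ∀ p r → p +ₚ r ≋ r +ₚ p
    +-comm p r = pointwise _ _ (coeff-+ p r) (coeff-+ r p) λ i → ℤP.+-comm (coeff p i) (coeff r i)

    +-assoc : ∀ p r s → (p +ₚ r) +ₚ s ≋ p +ₚ (r +ₚ s)
    +-assoc p r s = pointwise _ _
      (λ i → ≡.trans (coeff-+ (p +ₚ r) s i) (cong (ℤ._+ coeff s i) (coeff-+ p r i)))
      (λ i → ≡.trans (coeff-+ p (r +ₚ s) i) (cong (λ x → coeff p i ℤ.+ x) (coeff-+ r s i)))
      λ i → ℤP.+-assoc (coeff p i) (coeff r i) (coeff s i)

    +-interchange : ∀ w x y z → (w +ₚ x) +ₚ (y +ₚ z) ≋ (w +ₚ y) +ₚ (x +ₚ z)
    +-interchange w x y z = pointwise _ _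
      (λ i → ≡.trans (coeff-+ (w +ₚ x) (y +ₚ z) i) (cong₂ ℤ._+_ (coeff-+ w x i) (coeff-+ y z i)))
      (λ i → ≡.trans (coeff-+ (w +ₚ y) (x +ₚ z) i) (cong₂ ℤ._+_ (coeff-+ w y i) (coeff-+ x z i)))
      λ i → interchange (coeff w i) (coeff x i) (coeff y i) (coeff z i)
      where
      interchange : ∀ a b c d → (a ℤ.+ b) ℤ.+ (c ℤ.+ d) ≡ (a ℤ.+ c) ℤ.+ (b ℤ.+ d)
      interchange = ℤSolver.solve-∀

    +-identityʳ : ∀ p → p +ₚ 0ₚ ≋ p
    +-identityʳ []      = ≋-refl
    +-identityʳ (a ∷ p) = ≋-refl

    +-inverseˡ : ∀ p → negₚ p +ₚ p ≋ 0ₚ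
    +-inverseˡ p = pointwise _ (λ _ → + 0)
      (λ i → ≡.trans (coeff-+ (negₚ p) p i) (cong (ℤ._+ coeff p i) (coeff-neg p i))) (λ _ → refl)
      λ i → ℤP.+-inverseˡ (coeff p i)

    +-inverseʳ : ∀ p → p +ₚ negₚ p ≋ 0ₚ
    +-inverseʳ p = ≋-trans (+-comm p (negₚ p)) (+-inverseˡ p)

    sh-+ : ∀ p r → sh (p +ₚ r) ≋ sh p +ₚ sh r
    sh-+ p r = mk λ { zero → refl ; (suc i) → refl }

    ·-distrib-+ : ∀ c p r → c ·ₚ (p +ₚ r) ≋ c ·ₚ p +ₚ c ·ₚ r
    ·-distrib-+ c p r = pointwise _ _
      (λ i → ≡.trans (coeff-· c (p +ₚ r) i) (cong (c ℤ.*_) (coeff-+ p r i)))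
      (λ i → ≡.trans (coeff-+ (c ·ₚ p) (c ·ₚ r) i) (cong₂ ℤ._+_ (coeff-· c p i) (coeff-· c r i)))
      λ i → ℤP.*-distribˡ-+ c (coeff p i) (coeff r i)

    +-distrib-· : ∀ c d p → (c ℤ.+ d) ·ₚ p ≋ c ·ₚ p +ₚ d ·ₚ p
    +-distrib-· c d p = pointwise _ _ (coeff-· (c ℤ.+ d) p)
      (λ i → ≡.trans (coeff-+ (c ·ₚ p) (d ·ₚ p) i) (cong₂ ℤ._+_ (coeff-· c p i) (coeff-· d p i)))
      λ i → ℤP.*-distribʳ-+ (coeff p i) c d

    ·-assoc : ∀ c d p → c ·ₚ (d ·ₚ p) ≋ (c ℤ.* d) ·ₚ p
    ·-assoc c d p = pointwise _ _
      (λ i → ≡.trans (coeff-· c (d ·ₚ p) i) (cong (c ℤ.*_) (coeff-· d p i))) (coeff-· (c ℤ.* d) p)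
      λ i → ≡.sym (ℤP.*-assoc c d (coeff p i))

    ·-sh : ∀ c p → c ·ₚ sh p ≋ sh (c ·ₚ p)
    ·-sh c p = mk λ { zero → ℤP.*-zeroʳ c ; (suc i) → refl }

    0· : ∀ p → + 0 ·ₚ p ≋ 0ₚ
    0· p = mk (coeff-· (+ 0) p)

    1· : ∀ p → + 1 ·ₚ p ≋ p
    1· p = mk λ i → ≡.trans (coeff-· (+ 1) p i) (ℤP.*-identityˡ (coeff p i))

  open Additive

  module Multiplicative where

    *-zeroʳ : ∀ p → p *ₚ 0ₚ ≋ 0ₚ
    *-zeroʳ []      = ≋-refl
    *-zeroʳ (a ∷ p) = ≋-trans (sh-cong (*-zeroʳ p)) (mk λ { zero → refl ; (suc i) → refl })

    -- Polynomials equal to zero annihilate (their representation may carry zeros).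
    *-zeroˡ : ∀ p r → p ≋ 0ₚ → p *ₚ r ≋ 0ₚ
    *-zeroˡ []      r e      = ≋-refl
    *-zeroˡ (a ∷ p) r (mk e) with e zero
    ... | refl = ≋-trans (+-cong (0· r) (sh-cong (*-zeroˡ p r (mk λ i → e (suc i)))))
                         (mk λ { zero → refl ; (suc i) → refl })

    *-congʳ : ∀ p {r r′} → r ≋ r′ → p *ₚ r ≋ p *ₚ r′
    *-congʳ []      e = ≋-refl
    *-congʳ (a ∷ p) e = +-cong (·-cong a e) (sh-cong (*-congʳ p e))

    *-congˡ : ∀ {p p′} r → p ≋ p′ → p *ₚ r ≋ p′ *ₚ r
    *-congˡ {[]}    {p′}     r e      = ≋-sym (*-zeroˡ p′ r (≋-sym e))
    *-congˡ {a ∷ p} {[]}     r e      = *-zeroˡ (a ∷ p) r e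
    *-congˡ {a ∷ p} {b ∷ p′} r (mk e) with e zero
    ... | refl = +-cong ≋-refl (sh-cong (*-congˡ {p} {p′} r (mk λ i → e (suc i))))

    *-cong : ∀ {p p′ r r′} → p ≋ p′ → r ≋ r′ → p *ₚ r ≋ p′ *ₚ r′
    *-cong {p} {r′ = r′} e f = ≋-trans (*-congʳ p f) (*-congˡ r′ e)

    ·-* : ∀ c p r → c ·ₚ (p *ₚ r) ≋ (c ·ₚ p) *ₚ r
    ·-* c []      r = ≋-refl
    ·-* c (a ∷ p) r = ≋-trans (·-distrib-+ c (a ·ₚ r) (sh (p *ₚ r)))
      (+-cong (·-assoc c a r) (≋-trans (·-sh c (p *ₚ r)) (sh-cong (·-* c p r))))

    sh-* : ∀ p r → sh p *ₚ r ≋ sh (p *ₚ r)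
    sh-* p r = +-cong (0· r) ≋-refl

    *-distribʳ : ∀ p p′ r → (p +ₚ p′) *ₚ r ≋ p *ₚ r +ₚ p′ *ₚ r
    *-distribʳ []      p′       r = ≋-refl
    *-distribʳ (a ∷ p) []       r = ≋-sym (+-identityʳ _)
    *-distribʳ (a ∷ p) (b ∷ p′) r =
      ≋-trans (+-cong (+-distrib-· a b r) (≋-trans (sh-cong (*-distribʳ p p′ r)) (sh-+ (p *ₚ r) (p′ *ₚ r))))
              (+-interchange (a ·ₚ r) (b ·ₚ r) (sh (p *ₚ r)) (sh (p′ *ₚ r)))

    *-distribˡ : ∀ p r r′ → p *ₚ (r +ₚ r′) ≋ p *ₚ r +ₚ p *ₚ r′
    *-distribˡ []      r r′ = ≋-refl
    *-distribˡ (a ∷ p) r r′ =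
      ≋-trans (+-cong (·-distrib-+ a r r′) (≋-trans (sh-cong (*-distribˡ p r r′)) (sh-+ (p *ₚ r) (p *ₚ r′))))
              (+-interchange (a ·ₚ r) (a ·ₚ r′) (sh (p *ₚ r)) (sh (p *ₚ r′)))

    *-assoc : ∀ p r s → (p *ₚ r) *ₚ s ≋ p *ₚ (r *ₚ s)
    *-assoc []      r s = ≋-refl
    *-assoc (a ∷ p) r s = ≋-trans (*-distribʳ (a ·ₚ r) (sh (p *ₚ r)) s)
      (+-cong (≋-sym (·-* a r s)) (≋-trans (sh-* (p *ₚ r) s) (sh-cong (*-assoc p r s))))

    *-identityˡ : ∀ p → 1ₚ *ₚ p ≋ p
    *-identityˡ p = ≋-trans (+-cong (1· p) (mk λ { zero → refl ; (suc i) → refl })) (+-identityʳ p)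

    *-cons : ∀ p b r → p *ₚ (b ∷ r) ≋ b ·ₚ p +ₚ sh (p *ₚ r)
    *-cons []      b r = mk λ { zero → refl ; (suc i) → refl }
    *-cons (a ∷ p) b r = cons-cong (cong (ℤ._+ + 0) (ℤP.*-comm a b))
      (≋-trans (+-cong ≋-refl (*-cons p b r))
      (≋-trans (≋-sym (+-assoc (a ·ₚ r) (b ·ₚ p) (sh (p *ₚ r))))
      (≋-trans (+-cong (+-comm (a ·ₚ r) (b ·ₚ p)) ≋-refl) (+-assoc (b ·ₚ p) (a ·ₚ r) (sh (p *ₚ r))))))

    *-comm : ∀ p r → p *ₚ r ≋ r *ₚ p
    *-comm []      r = ≋-sym (*-zeroʳ r)
    *-comm (a ∷ p) r = ≋-trans (+-cong ≋-refl (sh-cong (*-comm p r))) (≋-sym (*-cons r a p))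

    *-identityʳ : ∀ p → p *ₚ 1ₚ ≋ p
    *-identityʳ p = ≋-trans (*-comm p 1ₚ) (*-identityˡ p)

  open Multiplicative

  PolyCR : CommutativeRing _ _
  PolyCR = record
    { Carrier = Poly ; _≈_ = _≋_ ; _+_ = _+ₚ_ ; _*_ = _*ₚ_ ; -_ = negₚ ; 0# = 0ₚ ; 1# = 1ₚ
    ; isCommutativeRing = record
      { isRing = record
        { +-isAbelianGroup = record
          { isGroup = record
            { isMonoid = record
              { isSemigroup = record
                { isMagma = record
                  { isEquivalence = record { refl = ≋-refl ; sym = ≋-sym ; trans = ≋-trans }
                  ; ∙-cong = +-cong }
                ; assoc = +-assoc }
              ; identity = (λ _ → ≋-refl) , +-identityʳ }
            ; inverse = +-inverseˡ , +-inverseʳ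
            ; ⁻¹-cong = ·-cong _ }
          ; comm = +-comm }
        ; *-cong = *-cong
        ; *-assoc = *-assoc
        ; *-identity = *-identityˡ , *-identityʳ
        ; distrib = *-distribˡ , (λ r p p′ → *-distribʳ p p′ r) }
      ; *-comm = *-comm } }

  -- A sound (incomplete) zero test, which lets the ring solver prune zero terms.
  isZero? : (p : Poly) → Maybe (0ₚ ≋ p)
  isZero? []        = just ≋-refl
  isZero? (+ 0 ∷ p) = Maybe.map (λ where (mk e) → mk λ { zero → refl ; (suc i) → e i }) (isZero? p)
  isZero? (_ ∷ p)   = nothing

  Polyℤ : AlmostCommutativeRing _ _
  Polyℤ = fromCommutativeRing PolyCR isZero?


open PolyRing using (PolyCR; Polyℤ)
open PolyRing.Additive using (0·; cons-cong)
open PolyRing.Multiplicative using (*-cons)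

open CommutativeRing PolyCR
  using (+-cong; +-congˡ; +-congʳ; *-cong; *-congˡ; *-congʳ; -‿cong; *-comm; *-assoc;
         *-identityˡ; *-identityʳ; +-identityʳ; zeroʳ; -‿inverseʳ; setoid; commutativeSemiring)
  renaming (refl to ≋-refl; sym to ≋-sym; trans to ≋-trans; reflexive to ≋-reflexive)
open import Relation.Binary.Reasoning.Setoid setoid
open import Algebra.Properties.CommutativeSemigroup (CommutativeRing.*-commutativeSemigroup PolyCR)
  using (interchange; x∙yz≈y∙xz; xy∙z≈y∙xz; x∙yz≈yx∙z; xy∙z≈xz∙y)

open import Algebra.Properties.CommutativeSemiring.Exp commutativeSemiring as Exp using (_^_)

^ₚ≡^ : ∀ p k → p ^ₚ k ≡ p ^ k
^ₚ≡^ p zero    = refl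
^ₚ≡^ p (suc k) = cong (p *ₚ_) (^ₚ≡^ p k)

^-cong : ∀ {p p′} k → p ≋ p′ → p ^ₚ k ≋ p′ ^ₚ k
^-cong {p} {p′} k e rewrite ^ₚ≡^ p k | ^ₚ≡^ p′ k = Exp.^-congˡ k e

^-+ : ∀ p a b → p ^ₚ (a + b) ≋ p ^ₚ a *ₚ p ^ₚ b
^-+ p a b rewrite ^ₚ≡^ p (a + b) | ^ₚ≡^ p a | ^ₚ≡^ p b = Exp.^-homo-* p a b

^-* : ∀ p a b → p ^ₚ (a * b) ≋ (p ^ₚ a) ^ₚ b
^-* p a b rewrite ^ₚ≡^ p (a * b) | ^ₚ≡^ p a | ^ₚ≡^ (p ^ a) b = ≋-sym (Exp.^-assocʳ p a b)

^-distrib-* : ∀ p r k → (p *ₚ r) ^ₚ k ≋ p ^ₚ k *ₚ r ^ₚ k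
^-distrib-* p r k rewrite ^ₚ≡^ (p *ₚ r) k | ^ₚ≡^ p k | ^ₚ≡^ r k = Exp.^-distrib-* p r k

1^ : ∀ k → 1ₚ ^ₚ k ≋ 1ₚ
1^ zero    = ≋-refl
1^ (suc k) = ≋-trans (*-identityˡ _) (1^ k)

coeff₀-* : ∀ p r → coeff (p *ₚ r) 0 ≡ coeff p 0 ℤ.* coeff r 0
coeff₀-* []      r = refl
coeff₀-* (a ∷ p) r = ≡.trans (coeff-+ (a ·ₚ r) (sh (p *ₚ r)) 0)
                             (≡.trans (ℤP.+-identityʳ _) (coeff-· a r 0))

coeff₀-- : ∀ p r → coeff (p -ₚ r) 0 ≡ coeff p 0 ℤ.- coeff r 0
coeff₀-- p r = ≡.trans (coeff-+ p (negₚ r) 0) (cong (λ x → coeff p 0 ℤ.+ x) (coeff-neg r 0))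

Nonzero : Poly → Set
Nonzero p = ¬ (p ≋ 0ₚ)

coeff₀-nonzero : ∀ p → coeff p 0 ≢ + 0 → Nonzero p
coeff₀-nonzero p ne (mk e) = ne (e 0)

-- A nonzero polynomial is not a zero divisor: strip the zero constant terms of
-- p, then compare the coefficients of p * r from the bottom.
no-zero-divisors : ∀ p r → Nonzero p → p *ₚ r ≋ 0ₚ → r ≋ 0ₚ
no-zero-divisors []      r nz e = ⊥-elim (nz ≋-refl)
no-zero-divisors (a ∷ p) r nz e with a ℤ.≟ + 0
... | yes refl = no-zero-divisors p r (λ (mk f) → nz (mk λ { zero → refl ; (suc i) → f i }))
                                      (mk λ i → get (≋-trans (≋-sym drop-zero) e) (suc i))
  where
  drop-zero : (+ 0 ∷ p) *ₚ r ≋ sh (p *ₚ r)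
  drop-zero = +-congʳ (0· r)
... | no a≢0   = nonzero-constant r e
  where
  -- When a ≠ 0, the lowest coefficient b of r satisfies a * b = 0.
  nonzero-constant : ∀ r → (a ∷ p) *ₚ r ≋ 0ₚ → r ≋ 0ₚ
  nonzero-constant []      e = ≋-refl
  nonzero-constant (b ∷ r) e = mk λ { zero → b≡0 ; (suc i) → get (nonzero-constant r shifted) i }
    where
    b≡0 : b ≡ + 0
    b≡0 with ℤP.i*j≡0⇒i≡0∨j≡0 a (≡.trans (≡.sym (coeff₀-* (a ∷ p) (b ∷ r))) (get e 0))
    ... | inj₁ a≡0 = ⊥-elim (a≢0 a≡0)
    ... | inj₂ b≡0 = b≡0
    shifted : (a ∷ p) *ₚ r ≋ 0ₚ
    shifted = mk λ i → ≡.trans (≡.sym (get drop-b (suc i))) (get e (suc i))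
      where
      drop-b : (a ∷ p) *ₚ (b ∷ r) ≋ sh ((a ∷ p) *ₚ r)
      drop-b = ≋-trans (*-cons (a ∷ p) b r)
                       (+-congʳ (≡.subst (λ c → c ·ₚ (a ∷ p) ≋ 0ₚ) (≡.sym b≡0) (0· (a ∷ p))))

*-nonzero : ∀ {p r} → Nonzero p → Nonzero r → Nonzero (p *ₚ r)
*-nonzero {p} {r} np nr e = nr (no-zero-divisors p r np e)

*-cancelˡ : ∀ b {x y} → Nonzero b → b *ₚ x ≋ b *ₚ y → x ≋ y
*-cancelˡ b {x} {y} nb e = begin
  x                  ≈⟨ split x y ⟩
  (x -ₚ y) +ₚ y      ≈⟨ +-congʳ (no-zero-divisors b (x -ₚ y) nb difference) ⟩
  0ₚ +ₚ y            ≡⟨⟩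
  y                  ∎
  where
  split : ∀ x y → x ≋ (x -ₚ y) +ₚ y
  split = solve-∀ Polyℤ
  distrib : ∀ b x y → b *ₚ (x -ₚ y) ≋ b *ₚ x -ₚ b *ₚ y
  distrib = solve-∀ Polyℤ
  cancel : ∀ z → z -ₚ z ≋ 0ₚ
  cancel = solve-∀ Polyℤ
  difference : b *ₚ (x -ₚ y) ≋ 0ₚ
  difference = ≋-trans (distrib b x y) (≋-trans (+-congʳ e) (cancel (b *ₚ y)))

-- Polynomials with constant term 1 (all the Pochhammer products below) are
-- nonzero, and this property is multiplicative.
ConstOne : Poly → Set
ConstOne p = coeff p 0 ≡ + 1

constOne-nonzero : ∀ p → ConstOne p → Nonzero p
constOne-nonzero p c = coeff₀-nonzero p (λ e → one≢zero (≡.trans (≡.sym c) e))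
  where
  one≢zero : + 1 ≢ + 0
  one≢zero ()

constOne-* : ∀ p r → ConstOne p → ConstOne r → ConstOne (p *ₚ r)
constOne-* p r cp cr = ≡.trans (coeff₀-* p r) (cong₂ ℤ._*_ cp cr)

constOne-^ : ∀ p k → ConstOne p → ConstOne (p ^ₚ k)
constOne-^ p zero    cp = refl
constOne-^ p (suc k) cp = constOne-* p (p ^ₚ k) cp (constOne-^ p k cp)

-- Rep F a b : the fraction F equals a / b, i.e. num F · b = a · den F, with both
-- denominators nonzero.  Every operation on Frac is tracked by a representation.
record Rep (F : Frac) (a b : Poly) : Set where
  constructor rep
  field
    cross       : num F *ₚ b ≋ a *ₚ den F
    den-nonzero : Nonzero (den F)
    b-nonzero   : Nonzero b
open Rep

nonzero-1 : Nonzero 1ₚ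
nonzero-1 = constOne-nonzero 1ₚ refl

rep-poly : ∀ p → Rep (poly p) p 1ₚ
rep-poly p = rep ≋-refl nonzero-1 nonzero-1

rep-* : ∀ {F G a b c d} → Rep F a b → Rep G c d → Rep (F *f G) (a *ₚ c) (b *ₚ d)
rep-* {F} {G} {a} {b} {c} {d} (rep e nF nb) (rep f nG nd) =
  rep (≋-trans (interchange (num F) (num G) b d) (≋-trans (*-cong e f) (interchange a (den F) c (den G))))
      (*-nonzero nF nG) (*-nonzero nb nd)

rep-+ : ∀ {F G a b c d} → Rep F a b → Rep G c d → Rep (F +f G) (a *ₚ d +ₚ c *ₚ b) (b *ₚ d)
rep-+ {F} {G} {a} {b} {c} {d} (rep e nF nb) (rep f nG nd) =
  rep (≋-trans (expand (num F) (num G) (den F) (den G) b d)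
      (≋-trans (+-cong (*-congʳ e) (*-congʳ f)) (collect a (den F) c (den G) b d)))
      (*-nonzero nF nG) (*-nonzero nb nd)
  where
  expand : ∀ x y u v b d → (x *ₚ v +ₚ y *ₚ u) *ₚ (b *ₚ d) ≋ (x *ₚ b) *ₚ (v *ₚ d) +ₚ (y *ₚ d) *ₚ (u *ₚ b)
  expand = solve-∀ Polyℤ
  collect : ∀ a u c v b d → (a *ₚ u) *ₚ (v *ₚ d) +ₚ (c *ₚ v) *ₚ (u *ₚ b) ≋ (a *ₚ d +ₚ c *ₚ b) *ₚ (u *ₚ v)
  collect = solve-∀ Polyℤ

rep-1- : ∀ {F a b} → Rep F a b → Rep (1-f F) (b -ₚ a) b
rep-1- {F} {a} {b} (rep e nF nb) =
  rep (≋-trans (expand (den F) (num F) b) (≋-trans (+-congˡ (-‿cong e)) (collect (den F) a b))) nF nb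
  where
  expand : ∀ u x b → (u -ₚ x) *ₚ b ≋ u *ₚ b -ₚ x *ₚ b
  expand = solve-∀ Polyℤ
  collect : ∀ u a b → u *ₚ b -ₚ a *ₚ u ≋ (b -ₚ a) *ₚ u
  collect = solve-∀ Polyℤ

rep-flip : ∀ {F a b} → Nonzero a → Rep F a b → Rep (den F , num F) b a
rep-flip {F} {a} {b} na (rep e nF nb) =
  rep (≋-trans (*-comm (den F) a) (≋-trans (≋-sym e) (*-comm (num F) b))) num-nonzero na
  where
  num-nonzero : Nonzero (num F)
  num-nonzero z = *-nonzero na nF (≋-trans (≋-sym e) (*-congʳ z))

rep-^ : ∀ {F a b} k → Rep F a b → Rep (F ^f k) (a ^ₚ k) (b ^ₚ k)
rep-^ zero    r = rep ≋-refl nonzero-1 nonzero-1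
rep-^ (suc k) r = rep-* r (rep-^ k r)

rep-cross : ∀ {F a b c d} → Rep F a b → Rep F c d → a *ₚ d ≋ c *ₚ b
rep-cross {F} {a} {b} {c} {d} (rep e nF _) (rep f _ _) = *-cancelˡ (den F) nF (begin
  den F *ₚ (a *ₚ d)   ≈⟨ x∙yz≈yx∙z (den F) a d ⟩
  (a *ₚ den F) *ₚ d   ≈⟨ *-congʳ (≋-sym e) ⟩
  (num F *ₚ b) *ₚ d   ≈⟨ xy∙z≈xz∙y (num F) b d ⟩
  (num F *ₚ d) *ₚ b   ≈⟨ *-congʳ f ⟩
  (c *ₚ den F) *ₚ b   ≈⟨ ≋-sym (x∙yz≈yx∙z (den F) c b) ⟩
  den F *ₚ (c *ₚ b)   ∎)

rep-change : ∀ {F a b a′ b′} → Rep F a b → a *ₚ b′ ≋ a′ *ₚ b → Nonzero b′ → Rep F a′ b′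
rep-change {F} {a} {b} {a′} {b′} (rep e nF nb) f nb′ = rep (*-cancelˡ b nb (begin
  b *ₚ (num F *ₚ b′)    ≈⟨ x∙yz≈yx∙z b (num F) b′ ⟩
  (num F *ₚ b) *ₚ b′    ≈⟨ *-congʳ e ⟩
  (a *ₚ den F) *ₚ b′    ≈⟨ xy∙z≈xz∙y a (den F) b′ ⟩
  (a *ₚ b′) *ₚ den F    ≈⟨ *-congʳ f ⟩
  (a′ *ₚ b) *ₚ den F    ≈⟨ ≋-sym (x∙yz≈yx∙z b a′ (den F)) ⟩
  b *ₚ (a′ *ₚ den F)    ∎)) nF nb′

rep-resp : ∀ {F a b a′ b′} → Rep F a b → a ≋ a′ → b ≋ b′ → Rep F a′ b′
rep-resp {a = a} {b} {a′} {b′} r ea eb =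
  rep-change r (≋-trans (*-congˡ {a} (≋-sym eb)) (*-congʳ ea)) (λ z → b-nonzero r (≋-trans eb z))

geom : Poly → ℕ → Poly
geom y zero    = 0ₚ
geom y (suc k) = 1ₚ +ₚ y *ₚ geom y k

geom-closed : ∀ y k → (1ₚ -ₚ y) *ₚ geom y k ≋ 1ₚ -ₚ y ^ₚ k
geom-closed y zero    = ≋-trans (zeroʳ (1ₚ -ₚ y)) (≋-sym (-‿inverseʳ 1ₚ))
geom-closed y (suc k) = begin
  (1ₚ -ₚ y) *ₚ (1ₚ +ₚ y *ₚ g)        ≈⟨ expand y g ⟩
  (1ₚ -ₚ y) +ₚ y *ₚ ((1ₚ -ₚ y) *ₚ g) ≈⟨ +-congˡ {1ₚ -ₚ y} (*-congˡ {y} (geom-closed y k)) ⟩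
  (1ₚ -ₚ y) +ₚ y *ₚ (1ₚ -ₚ y ^ₚ k)   ≈⟨ collect y (y ^ₚ k) ⟩
  1ₚ -ₚ y *ₚ y ^ₚ k                  ∎
  where
  g = geom y k
  expand : ∀ y g → (1ₚ -ₚ y) *ₚ (1ₚ +ₚ y *ₚ g) ≋ (1ₚ -ₚ y) +ₚ y *ₚ ((1ₚ -ₚ y) *ₚ g)
  expand = solve-∀ Polyℤ
  collect : ∀ y z → (1ₚ -ₚ y) +ₚ y *ₚ (1ₚ -ₚ z) ≋ 1ₚ -ₚ y *ₚ z
  collect = solve-∀ Polyℤ

qint≡geom : ∀ j → qint j ≡ geom qₚ j
qint≡geom zero    = refl
qint≡geom (suc j) = cong (λ g → 1ₚ +ₚ qₚ *ₚ g) (qint≡geom j)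

qint-constOne : ∀ j → ConstOne (qint (suc j))
qint-constOne j = ≡.trans (coeff-+ 1ₚ (qₚ *ₚ qint j) 0) (cong (λ x → + 1 ℤ.+ x) (coeff₀-* qₚ (qint j)))

qint-closed : ∀ j → (1ₚ -ₚ qₚ) *ₚ qint j ≋ 1ₚ -ₚ qₚ ^ₚ j
qint-closed j rewrite qint≡geom j = geom-closed qₚ j

prodₚ : Poly → Poly → Poly → ℕ → Poly
prodₚ a b c zero    = 1ₚ
prodₚ a b c (suc k) = prodₚ a b c k *ₚ (b -ₚ a *ₚ c ^ₚ k)

pochₚ : Poly → Poly → ℕ → Poly
pochₚ a c = prodₚ a 1ₚ c

rep-poch : ∀ {x p a b c} k → Rep x a b → Rep p c 1ₚ → Rep (poch x p k) (prodₚ a b c k) (b ^ₚ k)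
rep-poch zero rx rp = rep ≋-refl nonzero-1 nonzero-1
rep-poch {a = a} {b} {c} (suc k) rx rp =
  rep-resp (rep-* (rep-poch k rx rp) (rep-1- (rep-* rx (rep-^ k rp))))
           (*-congˡ {prodₚ a b c k} (+-congʳ {negₚ (a *ₚ c ^ₚ k)} b·1≋b))
           (≋-trans (*-congˡ {b ^ₚ k} b·1≋b) (*-comm (b ^ₚ k) b))
  where
  b·1≋b : b *ₚ 1ₚ ^ₚ k ≋ b
  b·1≋b = ≋-trans (*-congˡ {b} (1^ k)) (*-identityʳ b)

prodₚ-cong : ∀ {a a′} b c k → a ≋ a′ → prodₚ a b c k ≋ prodₚ a′ b c k
prodₚ-cong b c zero    e = ≋-refl
prodₚ-cong b c (suc k) e = *-cong (prodₚ-cong b c k e) (+-congˡ (-‿cong (*-congʳ e)))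

prodₚ-peel : ∀ a b c k → prodₚ a b c (suc k) ≋ (b -ₚ a) *ₚ prodₚ (a *ₚ c) b c k
prodₚ-peel a b c zero    = first a b
  where
  first : ∀ a b → 1ₚ *ₚ (b -ₚ a *ₚ 1ₚ) ≋ (b -ₚ a) *ₚ 1ₚ
  first = solve-∀ Polyℤ
prodₚ-peel a b c (suc k) = ≋-trans (*-congʳ (prodₚ-peel a b c k)) (regroup a b c (c ^ₚ k) (prodₚ (a *ₚ c) b c k))
  where
  regroup : ∀ a b c d P → ((b -ₚ a) *ₚ P) *ₚ (b -ₚ a *ₚ (c *ₚ d)) ≋ (b -ₚ a) *ₚ (P *ₚ (b -ₚ (a *ₚ c) *ₚ d))
  regroup = solve-∀ Polyℤ

prodₚ-scale : ∀ s a c k → prodₚ (s *ₚ a) s c k ≋ s ^ₚ k *ₚ pochₚ a c k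
prodₚ-scale s a c zero    = ≋-sym (*-identityˡ 1ₚ)
prodₚ-scale s a c (suc k) = ≋-trans (*-congʳ (prodₚ-scale s a c k)) (regroup s a (c ^ₚ k) (s ^ₚ k) (pochₚ a c k))
  where
  regroup : ∀ s a d t P → (t *ₚ P) *ₚ (s -ₚ (s *ₚ a) *ₚ d) ≋ (s *ₚ t) *ₚ (P *ₚ (1ₚ -ₚ a *ₚ d))
  regroup = solve-∀ Polyℤ

pochₚ-constOne : ∀ a c k → coeff a 0 ≡ + 0 → ConstOne (pochₚ a c k)
pochₚ-constOne a c zero    a₀ = refl
pochₚ-constOne a c (suc k) a₀ = constOne-* (pochₚ a c k) _ (pochₚ-constOne a c k a₀)
  (≡.trans (coeff₀-- 1ₚ (a *ₚ c ^ₚ k))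
           (cong (λ x → + 1 ℤ.- x) (≡.trans (coeff₀-* a (c ^ₚ k)) (cong (ℤ._* coeff (c ^ₚ k) 0) a₀))))

q² q³ q⁴ : Poly
q² = qₚ ^ₚ 2
q³ = qₚ ^ₚ 3
q⁴ = qₚ ^ₚ 4

q-nonzero : Nonzero qₚ
q-nonzero (mk e) with e 1
... | ()

rep-q^ : ∀ j → Rep (q^ j) (qₚ ^ₚ j) 1ₚ
rep-q^ j = rep-resp (rep-^ j (rep-poly qₚ)) ≋-refl (1^ j)

rep-q⁻¹ : Rep q⁻¹f 1ₚ qₚ
rep-q⁻¹ = rep ≋-refl q-nonzero q-nonzero

-- The k-th summand is summandNum k / summandDen k, where
--   summandNum k = [4k+1] (q;q²)_k³ q^{2k} ∏_{j<k} (q - q^{2j})   and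
--   summandDen k = q^k sumDen k,   since (q⁻¹;q²)_k = q^{-k} ∏_{j<k} (q - q^{2j}).
sumNum sumDen summandNum summandDen : ℕ → Poly
sumNum m     = pochₚ q³ q² m ^ₚ 3 *ₚ pochₚ qₚ q² m
sumDen m     = pochₚ q² q² m ^ₚ 3 *ₚ pochₚ q⁴ q² m
summandNum k = ((qint (4 * k + 1) *ₚ prodₚ 1ₚ qₚ q² k) *ₚ pochₚ qₚ q² k ^ₚ 3) *ₚ qₚ ^ₚ (2 * k)
summandDen k = qₚ ^ₚ k *ₚ sumDen k

sumDen-constOne : ∀ m → ConstOne (sumDen m)
sumDen-constOne m = constOne-* (pochₚ q² q² m ^ₚ 3) (pochₚ q⁴ q² m) (constOne-^ (pochₚ q² q² m) 3 (pochₚ-constOne q² q² m refl))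
                                   (pochₚ-constOne q⁴ q² m refl)

summand-rep : ∀ k → Rep (summand k) (summandNum k) (summandDen k)
summand-rep k = rep-resp
  (rep-* (rep-* (rep-* (rep-* (rep-poly (qint (4 * k + 1))) (rep-poch k rep-q⁻¹ (rep-q^ 2)))
                       (rep-^ 3 (rep-poch k (rep-poly qₚ) (rep-q^ 2))))
                (rep-q^ (2 * k)))
         (rep-flip (constOne-nonzero _ (constOne-* (pochₚ q⁴ q² k) (pochₚ q² q² k ^ₚ 3) (pochₚ-constOne q⁴ q² k refl)
                                                       (constOne-^ (pochₚ q² q² k) 3 (pochₚ-constOne q² q² k refl))))
                   (rep-* (rep-poch k (rep-q^ 4) (rep-q^ 2)) (rep-^ 3 (rep-poch k (rep-q^ 2) (rep-q^ 2))))))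
  (≋-trans (*-congˡ {summandNum k} (*-cong (1^ k) (^-cong 3 (1^ k)))) (ones-right (summandNum k)))
  (≋-trans (*-cong (*-cong (*-congˡ {1ₚ *ₚ qₚ ^ₚ k} (^-cong 3 (1^ k))) ≋-refl) ≋-refl)
           (ones-den (qₚ ^ₚ k) (pochₚ q⁴ q² k) (pochₚ q² q² k ^ₚ 3)))
  where
  ones-right : ∀ x → x *ₚ (1ₚ *ₚ (1ₚ *ₚ (1ₚ *ₚ (1ₚ *ₚ 1ₚ)))) ≋ x
  ones-right = solve-∀ Polyℤ
  ones-den : ∀ y t r → (((1ₚ *ₚ y) *ₚ (1ₚ *ₚ (1ₚ *ₚ (1ₚ *ₚ 1ₚ)))) *ₚ 1ₚ) *ₚ (t *ₚ r) ≋ y *ₚ (r *ₚ t)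
  ones-den = solve-∀ Polyℤ

q^even : ∀ k → qₚ ^ₚ (2 * k) ≋ q² ^ₚ k
q^even k = ^-* qₚ 2 k

q^4k+1 : ∀ k → qₚ ^ₚ (4 * k + 1) ≋ qₚ *ₚ (q² ^ₚ k *ₚ q² ^ₚ k)
q^4k+1 k = begin
  qₚ ^ₚ (4 * k + 1)                   ≈⟨ ^-+ qₚ (4 * k) 1 ⟩
  qₚ ^ₚ (4 * k) *ₚ qₚ ^ₚ 1            ≡⟨ cong (λ e → qₚ ^ₚ e *ₚ qₚ ^ₚ 1) (ℕP.*-distribʳ-+ k 2 2) ⟩
  qₚ ^ₚ (2 * k + 2 * k) *ₚ qₚ ^ₚ 1    ≈⟨ *-congʳ (^-+ qₚ (2 * k) (2 * k)) ⟩
  (qₚ ^ₚ (2 * k) *ₚ qₚ ^ₚ (2 * k)) *ₚ qₚ ^ₚ 1 ≈⟨ *-congʳ (*-cong (q^even k) (q^even k)) ⟩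
  (q² ^ₚ k *ₚ q² ^ₚ k) *ₚ qₚ ^ₚ 1    ≈⟨ swap (q² ^ₚ k *ₚ q² ^ₚ k) qₚ ⟩
  qₚ *ₚ (q² ^ₚ k *ₚ q² ^ₚ k)          ∎
  where
  swap : ∀ x q → x *ₚ (q *ₚ 1ₚ) ≋ q *ₚ x
  swap = solve-∀ Polyℤ

-- The polynomial identity behind the telescoping, with X = q^{2m}:
--   q(1-q²X)³(1-q⁴X) + (q-1)(1-q)³ q²X [4m+5] = q(1-q³X)³(1-qX),
-- using (1-q)[4m+5] = 1 - q⁵X².
key-identity : ∀ q X I → (1ₚ -ₚ q) *ₚ I ≋ 1ₚ -ₚ q *ₚ ((q ^ₚ 2 *ₚ X) *ₚ (q ^ₚ 2 *ₚ X)) →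
  q *ₚ ((1ₚ -ₚ q ^ₚ 2 *ₚ X) ^ₚ 3 *ₚ (1ₚ -ₚ q ^ₚ 4 *ₚ X))
    +ₚ ((q -ₚ 1ₚ) *ₚ (1ₚ -ₚ q) ^ₚ 3) *ₚ ((q ^ₚ 2 *ₚ X) *ₚ I)
  ≋ q *ₚ ((1ₚ -ₚ q ^ₚ 3 *ₚ X) ^ₚ 3 *ₚ (1ₚ -ₚ q *ₚ X))
key-identity q X I hyp = ≋-trans (extract q X I)
  (≋-trans (+-congˡ {q *ₚ ((1ₚ -ₚ q ^ₚ 2 *ₚ X) ^ₚ 3 *ₚ (1ₚ -ₚ q ^ₚ 4 *ₚ X))}
                    (*-congˡ {((q -ₚ 1ₚ) *ₚ (1ₚ -ₚ q) ^ₚ 2) *ₚ (q ^ₚ 2 *ₚ X)} hyp))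
           (identity q X))
  where
  extract : ∀ q X I →
    q *ₚ ((1ₚ -ₚ (q *ₚ (q *ₚ 1ₚ)) *ₚ X) *ₚ ((1ₚ -ₚ (q *ₚ (q *ₚ 1ₚ)) *ₚ X) *ₚ ((1ₚ -ₚ (q *ₚ (q *ₚ 1ₚ)) *ₚ X) *ₚ 1ₚ)) *ₚ (1ₚ -ₚ (q *ₚ (q *ₚ (q *ₚ (q *ₚ 1ₚ)))) *ₚ X))
      +ₚ ((q -ₚ 1ₚ) *ₚ ((1ₚ -ₚ q) *ₚ ((1ₚ -ₚ q) *ₚ ((1ₚ -ₚ q) *ₚ 1ₚ)))) *ₚ (((q *ₚ (q *ₚ 1ₚ)) *ₚ X) *ₚ I)
    ≋ q *ₚ ((1ₚ -ₚ (q *ₚ (q *ₚ 1ₚ)) *ₚ X) *ₚ ((1ₚ -ₚ (q *ₚ (q *ₚ 1ₚ)) *ₚ X) *ₚ ((1ₚ -ₚ (q *ₚ (q *ₚ 1ₚ)) *ₚ X) *ₚ 1ₚ)) *ₚ (1ₚ -ₚ (q *ₚ (q *ₚ (q *ₚ (q *ₚ 1ₚ)))) *ₚ X))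
      +ₚ (((q -ₚ 1ₚ) *ₚ ((1ₚ -ₚ q) *ₚ ((1ₚ -ₚ q) *ₚ 1ₚ))) *ₚ ((q *ₚ (q *ₚ 1ₚ)) *ₚ X)) *ₚ ((1ₚ -ₚ q) *ₚ I)
  extract = solve-∀ Polyℤ
  identity : ∀ q X →
    q *ₚ ((1ₚ -ₚ (q *ₚ (q *ₚ 1ₚ)) *ₚ X) *ₚ ((1ₚ -ₚ (q *ₚ (q *ₚ 1ₚ)) *ₚ X) *ₚ ((1ₚ -ₚ (q *ₚ (q *ₚ 1ₚ)) *ₚ X) *ₚ 1ₚ)) *ₚ (1ₚ -ₚ (q *ₚ (q *ₚ (q *ₚ (q *ₚ 1ₚ)))) *ₚ X))
      +ₚ (((q -ₚ 1ₚ) *ₚ ((1ₚ -ₚ q) *ₚ ((1ₚ -ₚ q) *ₚ 1ₚ))) *ₚ ((q *ₚ (q *ₚ 1ₚ)) *ₚ X)) *ₚ (1ₚ -ₚ q *ₚ (((q *ₚ (q *ₚ 1ₚ)) *ₚ X) *ₚ ((q *ₚ (q *ₚ 1ₚ)) *ₚ X)))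
    ≋ q *ₚ ((1ₚ -ₚ (q *ₚ (q *ₚ (q *ₚ 1ₚ))) *ₚ X) *ₚ ((1ₚ -ₚ (q *ₚ (q *ₚ (q *ₚ 1ₚ))) *ₚ X) *ₚ ((1ₚ -ₚ (q *ₚ (q *ₚ (q *ₚ 1ₚ))) *ₚ X) *ₚ 1ₚ)) *ₚ (1ₚ -ₚ q *ₚ X))
  identity = solve-∀ Polyℤ

-- If the ratios of consecutive numerators and denominators are c and e, and the
-- next summand is C y a / (s y E e) with s e + a = s c, then adding that summand
-- to C / E gives the next closed form (C c) / (E e).
telescope-step : ∀ C E c e y s a → s *ₚ e +ₚ a ≋ s *ₚ c →
  (C *ₚ ((s *ₚ y) *ₚ (E *ₚ e)) +ₚ (C *ₚ (y *ₚ a)) *ₚ E) *ₚ (E *ₚ e)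
  ≋ (C *ₚ c) *ₚ (E *ₚ ((s *ₚ y) *ₚ (E *ₚ e)))
telescope-step C E c e y s a hyp = begin
  (C *ₚ ((s *ₚ y) *ₚ (E *ₚ e)) +ₚ (C *ₚ (y *ₚ a)) *ₚ E) *ₚ (E *ₚ e) ≈⟨ factor C E e y s a ⟩
  (((C *ₚ y) *ₚ E) *ₚ (E *ₚ e)) *ₚ (s *ₚ e +ₚ a)                 ≈⟨ *-congˡ {((C *ₚ y) *ₚ E) *ₚ (E *ₚ e)} hyp ⟩
  (((C *ₚ y) *ₚ E) *ₚ (E *ₚ e)) *ₚ (s *ₚ c)                      ≈⟨ unfactor C E c e y s ⟩
  (C *ₚ c) *ₚ (E *ₚ ((s *ₚ y) *ₚ (E *ₚ e)))                      ∎
  where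
  factor : ∀ C E e y s a → (C *ₚ ((s *ₚ y) *ₚ (E *ₚ e)) +ₚ (C *ₚ (y *ₚ a)) *ₚ E) *ₚ (E *ₚ e)
                            ≋ (((C *ₚ y) *ₚ E) *ₚ (E *ₚ e)) *ₚ (s *ₚ e +ₚ a)
  factor = solve-∀ Polyℤ
  unfactor : ∀ C E c e y s → (((C *ₚ y) *ₚ E) *ₚ (E *ₚ e)) *ₚ (s *ₚ c) ≋ (C *ₚ c) *ₚ (E *ₚ ((s *ₚ y) *ₚ (E *ₚ e)))
  unfactor = solve-∀ Polyℤ

-- Passing from m to m+1 multiplies each (a;q²)_m by (1 - aX), X = q^{2m}; this
-- identifies the data of telescope-step for the closed form.
module Step (m : ℕ) where
  X Y I : Poly
  X = q² ^ₚ m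
  Y = qₚ ^ₚ m
  I = qint (4 * suc m + 1)

  c e a : Poly
  c = (1ₚ -ₚ q³ *ₚ X) ^ₚ 3 *ₚ (1ₚ -ₚ qₚ *ₚ X)
  e = (1ₚ -ₚ q² *ₚ X) ^ₚ 3 *ₚ (1ₚ -ₚ q⁴ *ₚ X)
  a = ((qₚ -ₚ 1ₚ) *ₚ (1ₚ -ₚ qₚ) ^ₚ 3) *ₚ ((q² *ₚ X) *ₚ I)

  cube-split : ∀ u v x y → (u *ₚ x) ^ₚ 3 *ₚ (v *ₚ y) ≋ (u ^ₚ 3 *ₚ v) *ₚ (x ^ₚ 3 *ₚ y)
  cube-split = cube-split′
    where
    cube-split′ : ∀ u v x y → ((u *ₚ x) *ₚ ((u *ₚ x) *ₚ ((u *ₚ x) *ₚ 1ₚ))) *ₚ (v *ₚ y)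
                              ≋ ((u *ₚ (u *ₚ (u *ₚ 1ₚ))) *ₚ v) *ₚ ((x *ₚ (x *ₚ (x *ₚ 1ₚ))) *ₚ y)
    cube-split′ = solve-∀ Polyℤ

  sumNum-suc : sumNum (suc m) ≋ sumNum m *ₚ c
  sumNum-suc = cube-split (pochₚ q³ q² m) (pochₚ qₚ q² m) (1ₚ -ₚ q³ *ₚ X) (1ₚ -ₚ qₚ *ₚ X)

  sumDen-suc : sumDen (suc m) ≋ sumDen m *ₚ e
  sumDen-suc = cube-split (pochₚ q² q² m) (pochₚ q⁴ q² m) (1ₚ -ₚ q² *ₚ X) (1ₚ -ₚ q⁴ *ₚ X)

  summandDen-suc : summandDen (suc m) ≋ (qₚ *ₚ Y) *ₚ (sumDen m *ₚ e)
  summandDen-suc = *-congˡ {qₚ *ₚ Y} sumDen-suc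

  shifted-poch : prodₚ 1ₚ qₚ q² (suc m) ≋ (qₚ -ₚ 1ₚ) *ₚ (Y *ₚ pochₚ qₚ q² m)
  shifted-poch = ≋-trans (prodₚ-peel 1ₚ qₚ q² m)
    (*-congˡ {qₚ -ₚ 1ₚ} (≋-trans (prodₚ-cong qₚ q² m (square qₚ)) (prodₚ-scale qₚ qₚ q² m)))
    where
    square : ∀ q → 1ₚ *ₚ (q *ₚ (q *ₚ 1ₚ)) ≋ q *ₚ q
    square = solve-∀ Polyℤ

  summandNum-suc : summandNum (suc m) ≋ sumNum m *ₚ (Y *ₚ a)
  summandNum-suc = ≋-trans
    (*-cong (*-cong (*-congˡ {I} shifted-poch) (^-cong 3 (prodₚ-peel qₚ 1ₚ q² m))) (q^even (suc m)))
    (regroup I (qₚ -ₚ 1ₚ) Y (pochₚ qₚ q² m) (1ₚ -ₚ qₚ) (pochₚ q³ q² m) (q² *ₚ X))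
    where
    regroup : ∀ I r Y P u Q z → ((I *ₚ (r *ₚ (Y *ₚ P))) *ₚ (u *ₚ Q) ^ₚ 3) *ₚ z
                                ≋ (Q ^ₚ 3 *ₚ P) *ₚ (Y *ₚ ((r *ₚ u ^ₚ 3) *ₚ (z *ₚ I)))
    regroup = regroup′
      where
      regroup′ : ∀ I r Y P u Q z →
        ((I *ₚ (r *ₚ (Y *ₚ P))) *ₚ ((u *ₚ Q) *ₚ ((u *ₚ Q) *ₚ ((u *ₚ Q) *ₚ 1ₚ)))) *ₚ z
        ≋ ((Q *ₚ (Q *ₚ (Q *ₚ 1ₚ))) *ₚ P) *ₚ (Y *ₚ ((r *ₚ (u *ₚ (u *ₚ (u *ₚ 1ₚ)))) *ₚ (z *ₚ I)))
      regroup′ = solve-∀ Polyℤ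

  ratio-identity : qₚ *ₚ e +ₚ a ≋ qₚ *ₚ c
  ratio-identity = key-identity qₚ X I (≋-trans (qint-closed (4 * suc m + 1))
                                                (+-congˡ {1ₚ} (-‿cong (q^4k+1 (suc m)))))

  telescoping : (sumNum m *ₚ summandDen (suc m) +ₚ summandNum (suc m) *ₚ sumDen m) *ₚ sumDen (suc m)
                ≋ sumNum (suc m) *ₚ (sumDen m *ₚ summandDen (suc m))
  telescoping = begin
    (sumNum m *ₚ summandDen (suc m) +ₚ summandNum (suc m) *ₚ sumDen m) *ₚ sumDen (suc m)
      ≈⟨ *-cong (+-cong (*-congˡ {sumNum m} summandDen-suc) (*-congʳ summandNum-suc)) sumDen-suc ⟩
    (C *ₚ ((qₚ *ₚ Y) *ₚ (E *ₚ e)) +ₚ (C *ₚ (Y *ₚ a)) *ₚ E) *ₚ (E *ₚ e)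
      ≈⟨ telescope-step C E c e Y qₚ a ratio-identity ⟩
    (C *ₚ c) *ₚ (E *ₚ ((qₚ *ₚ Y) *ₚ (E *ₚ e)))
      ≈⟨ ≋-sym (*-cong sumNum-suc (*-congˡ {E} summandDen-suc)) ⟩
    sumNum (suc m) *ₚ (sumDen m *ₚ summandDen (suc m)) ∎
    where
    C = sumNum m
    E = sumDen m

partialSum-rep : ∀ m → Rep (sumf summand m) (sumNum m) (sumDen m)
partialSum-rep zero    = rep-change (summand-rep 0) both-one (constOne-nonzero _ (sumDen-constOne 0))
  where
  -- at m = 0 all four polynomials are the constant 1
  both-one : summandNum 0 *ₚ sumDen 0 ≋ sumNum 0 *ₚ summandDen 0
  both-one = mk λ { zero → refl ; (suc zero) → refl ; (suc (suc zero)) → refl ; (suc (suc (suc i))) → refl }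
partialSum-rep (suc m) = rep-change (rep-+ (partialSum-rep m) (summand-rep (suc m))) (Step.telescoping m)
                                    (constOne-nonzero _ (sumDen-constOne (suc m)))


poch-neg : ∀ a c k → pochₚ a c k *ₚ pochₚ (negₚ a) c k ≋ pochₚ (a ^ₚ 2) (c ^ₚ 2) k
poch-neg a c zero    = *-identityˡ 1ₚ
poch-neg a c (suc k) = begin
  (P *ₚ (1ₚ -ₚ a *ₚ d)) *ₚ (M *ₚ (1ₚ -ₚ negₚ a *ₚ d))   ≈⟨ pair P M a d ⟩
  (P *ₚ M) *ₚ (1ₚ -ₚ a ^ₚ 2 *ₚ (d *ₚ d))               ≈⟨ *-cong (poch-neg a c k) (+-congˡ {1ₚ} (-‿cong (*-congˡ {a ^ₚ 2} even))) ⟩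
  pochₚ (a ^ₚ 2) (c ^ₚ 2) k *ₚ (1ₚ -ₚ a ^ₚ 2 *ₚ (c ^ₚ 2) ^ₚ k) ∎
  where
  P = pochₚ a c k
  M = pochₚ (negₚ a) c k
  d = c ^ₚ k
  pair : ∀ P M a d → (P *ₚ (1ₚ -ₚ a *ₚ d)) *ₚ (M *ₚ (1ₚ -ₚ negₚ a *ₚ d))
                     ≋ (P *ₚ M) *ₚ (1ₚ -ₚ (a *ₚ (a *ₚ 1ₚ)) *ₚ (d *ₚ d))
  pair = solve-∀ Polyℤ
  even : d *ₚ d ≋ (c ^ₚ 2) ^ₚ k
  even = ≋-trans (≋-sym (^-distrib-* c c k)) (^-cong k (≋-sym (*-congˡ {c} (*-identityʳ c))))

-- (a;c²)_m (ac;c²)_m = (a;c)_{2m}: the factors of (a;c)_{2m} split by parity of j.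
poch-parity : ∀ a c m → pochₚ a (c ^ₚ 2) m *ₚ pochₚ (a *ₚ c) (c ^ₚ 2) m ≋ pochₚ a c (2 * m)
poch-parity a c zero    = *-identityˡ 1ₚ
poch-parity a c (suc m) = begin
  (E *ₚ (1ₚ -ₚ a *ₚ x)) *ₚ (O *ₚ (1ₚ -ₚ (a *ₚ c) *ₚ x))
    ≈⟨ pair E O a c x ⟩
  ((E *ₚ O) *ₚ (1ₚ -ₚ a *ₚ x)) *ₚ (1ₚ -ₚ a *ₚ (c *ₚ x))
    ≈⟨ *-cong (*-cong (poch-parity a c m) (+-congˡ {1ₚ} (-‿cong (*-congˡ {a} x≋))))
              (+-congˡ {1ₚ} (-‿cong (*-congˡ {a} (*-congˡ {c} x≋)))) ⟩
  pochₚ a c (suc (suc (2 * m)))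
    ≡⟨ cong (pochₚ a c) (≡.sym (ℕP.*-suc 2 m)) ⟩
  pochₚ a c (2 * suc m) ∎
  where
  E = pochₚ a (c ^ₚ 2) m
  O = pochₚ (a *ₚ c) (c ^ₚ 2) m
  x = (c ^ₚ 2) ^ₚ m
  x≋ : x ≋ c ^ₚ (2 * m)
  x≋ = ≋-sym (^-* c 2 m)
  pair : ∀ E O a c x → (E *ₚ (1ₚ -ₚ a *ₚ x)) *ₚ (O *ₚ (1ₚ -ₚ (a *ₚ c) *ₚ x))
                       ≋ ((E *ₚ O) *ₚ (1ₚ -ₚ a *ₚ x)) *ₚ (1ₚ -ₚ a *ₚ (c *ₚ x))
  pair = solve-∀ Polyℤ

-- The q-factorial (q;q)_k and the Gaussian binomial [a+b choose a], defined by
-- the q-Pascal rule; the closed form shows that the latter is a polynomial.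
qPoch : ℕ → Poly
qPoch = pochₚ qₚ qₚ

qbinom : ℕ → ℕ → Poly
qbinom zero    b       = 1ₚ
qbinom (suc a) zero    = 1ₚ
qbinom (suc a) (suc b) = qbinom a (suc b) +ₚ qₚ ^ₚ suc a *ₚ qbinom (suc a) b

qbinom-closed : ∀ a b → (qPoch a *ₚ qPoch b) *ₚ qbinom a b ≋ qPoch (a + b)
qbinom-closed zero    b    = ≋-trans (*-identityʳ _) (*-identityˡ (qPoch b))
qbinom-closed (suc a) zero = ≋-trans (*-identityʳ _)
  (≋-trans (*-identityʳ (qPoch (suc a))) (≋-reflexive (cong qPoch (≡.sym (ℕP.+-identityʳ (suc a))))))
qbinom-closed (suc a) (suc b) = begin
  (qPoch (suc a) *ₚ qPoch (suc b)) *ₚ (qbinom a (suc b) +ₚ x *ₚ qbinom (suc a) b)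
    ≈⟨ pascal (qPoch a) (qPoch b) x y (qbinom a (suc b)) (qbinom (suc a) b) ⟩
  (1ₚ -ₚ x) *ₚ ((qPoch a *ₚ qPoch (suc b)) *ₚ qbinom a (suc b))
    +ₚ (x *ₚ (1ₚ -ₚ y)) *ₚ ((qPoch (suc a) *ₚ qPoch b) *ₚ qbinom (suc a) b)
    ≈⟨ +-cong (*-congˡ {1ₚ -ₚ x} (qbinom-closed a (suc b)))
              (*-congˡ {x *ₚ (1ₚ -ₚ y)} (≋-trans (qbinom-closed (suc a) b)
                                                 (≋-reflexive (cong qPoch (≡.sym (ℕP.+-suc a b)))))) ⟩
  (1ₚ -ₚ x) *ₚ qPoch (a + suc b) +ₚ (x *ₚ (1ₚ -ₚ y)) *ₚ qPoch (a + suc b)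
    ≈⟨ collect (qPoch (a + suc b)) x y ⟩
  qPoch (a + suc b) *ₚ (1ₚ -ₚ x *ₚ y)
    ≈⟨ *-congˡ {qPoch (a + suc b)} (+-congˡ {1ₚ} (-‿cong (≋-sym (^-+ qₚ (suc a) (suc b))))) ⟩
  qPoch (suc a + suc b) ∎
  where
  x = qₚ ^ₚ suc a
  y = qₚ ^ₚ suc b
  -- uses (q;q)_{k+1} = (q;q)_k (1 - q^{k+1}) on both factors
  pascal : ∀ A B x y G H → ((A *ₚ (1ₚ -ₚ x)) *ₚ (B *ₚ (1ₚ -ₚ y))) *ₚ (G +ₚ x *ₚ H)
    ≋ (1ₚ -ₚ x) *ₚ ((A *ₚ (B *ₚ (1ₚ -ₚ y))) *ₚ G) +ₚ (x *ₚ (1ₚ -ₚ y)) *ₚ (((A *ₚ (1ₚ -ₚ x)) *ₚ B) *ₚ H)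
  pascal = solve-∀ Polyℤ
  collect : ∀ Z x y → (1ₚ -ₚ x) *ₚ Z +ₚ (x *ₚ (1ₚ -ₚ y)) *ₚ Z ≋ Z *ₚ (1ₚ -ₚ x *ₚ y)
  collect = solve-∀ Polyℤ

-- (q³;q²)_m = (q;q²)_m [2m+1], after cancelling 1 - q from
-- (1-q)(q³;q²)_m = (q;q²)_{m+1} = (q;q²)_m (1 - q^{2m+1}).
poch-q³ : ∀ m → pochₚ q³ q² m ≋ pochₚ qₚ q² m *ₚ qint (2 * m + 1)
poch-q³ m = *-cancelˡ (1ₚ -ₚ qₚ) (coeff₀-nonzero _ λ ()) (begin
  (1ₚ -ₚ qₚ) *ₚ pochₚ q³ q² m              ≈⟨ ≋-sym (prodₚ-peel qₚ 1ₚ q² m) ⟩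
  pochₚ qₚ q² m *ₚ (1ₚ -ₚ qₚ *ₚ q² ^ₚ m)   ≈⟨ *-congˡ {pochₚ qₚ q² m} (+-congˡ {1ₚ} (-‿cong q^odd)) ⟩
  pochₚ qₚ q² m *ₚ (1ₚ -ₚ qₚ ^ₚ n)         ≈⟨ *-congˡ {pochₚ qₚ q² m} (≋-sym (qint-closed n)) ⟩
  pochₚ qₚ q² m *ₚ ((1ₚ -ₚ qₚ) *ₚ qint n)  ≈⟨ x∙yz≈y∙xz (pochₚ qₚ q² m) (1ₚ -ₚ qₚ) (qint n) ⟩
  (1ₚ -ₚ qₚ) *ₚ (pochₚ qₚ q² m *ₚ qint n)  ∎)
  where
  n = 2 * m + 1
  q^odd : qₚ *ₚ q² ^ₚ m ≋ qₚ ^ₚ n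
  q^odd = ≋-trans (*-congˡ {qₚ} (≋-sym (q^even m))) (≋-reflexive (cong (qₚ ^ₚ_) (ℕP.+-comm 1 (2 * m))))

-- (1+q)(q⁴;q²)_m = (q²;q²)_m [2m+2], after cancelling 1 - q from
-- (1-q²)(q⁴;q²)_m = (q²;q²)_{m+1} = (q²;q²)_m (1 - q^{2m+2}).
poch-q⁴ : ∀ m → (1ₚ +ₚ qₚ) *ₚ pochₚ q⁴ q² m ≋ pochₚ q² q² m *ₚ qint (2 * m + 2)
poch-q⁴ m = *-cancelˡ (1ₚ -ₚ qₚ) (coeff₀-nonzero _ λ ()) (begin
  (1ₚ -ₚ qₚ) *ₚ ((1ₚ +ₚ qₚ) *ₚ pochₚ q⁴ q² m)         ≈⟨ difference-of-squares qₚ (pochₚ q⁴ q² m) ⟩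
  (1ₚ -ₚ q²) *ₚ pochₚ q⁴ q² m                         ≈⟨ *-congˡ {1ₚ -ₚ q²} (prodₚ-cong 1ₚ q² m q⁴≋q²q²) ⟩
  (1ₚ -ₚ q²) *ₚ pochₚ (q² *ₚ q²) q² m                 ≈⟨ ≋-sym (prodₚ-peel q² 1ₚ q² m) ⟩
  pochₚ q² q² m *ₚ (1ₚ -ₚ q² *ₚ q² ^ₚ m)              ≈⟨ *-congˡ {pochₚ q² q² m} (+-congˡ {1ₚ} (-‿cong q^even′)) ⟩
  pochₚ q² q² m *ₚ (1ₚ -ₚ qₚ ^ₚ (2 * m + 2))          ≈⟨ *-congˡ {pochₚ q² q² m} (≋-sym (qint-closed (2 * m + 2))) ⟩
  pochₚ q² q² m *ₚ ((1ₚ -ₚ qₚ) *ₚ qint (2 * m + 2))   ≈⟨ x∙yz≈y∙xz (pochₚ q² q² m) (1ₚ -ₚ qₚ) (qint (2 * m + 2)) ⟩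
  (1ₚ -ₚ qₚ) *ₚ (pochₚ q² q² m *ₚ qint (2 * m + 2))   ∎)
  where
  difference-of-squares : ∀ q T → (1ₚ -ₚ q) *ₚ ((1ₚ +ₚ q) *ₚ T) ≋ (1ₚ -ₚ q *ₚ (q *ₚ 1ₚ)) *ₚ T
  difference-of-squares = solve-∀ Polyℤ
  q⁴≋q²q² : q⁴ ≋ q² *ₚ q²
  q⁴≋q²q² = ^-+ qₚ 2 2
  q^even′ : q² *ₚ q² ^ₚ m ≋ qₚ ^ₚ (2 * m + 2)
  q^even′ = ≋-trans (≋-sym (q^even (suc m)))
                    (≋-reflexive (cong (qₚ ^ₚ_) (≡.trans (ℕP.*-suc 2 m) (ℕP.+-comm 2 (2 * m)))))

negqPoch : ℕ → Poly
negqPoch = pochₚ (negₚ qₚ) qₚ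

-- Multiplying by (q;q)_m, and using
-- (q;q)_m (-q;q)_m = (q²;q²)_m and (q;q²)_m (q²;q²)_m = (q;q)_{2m}, this becomes
-- the closed form of the Gaussian binomial.
central-binomial : ∀ m → pochₚ qₚ q² m *ₚ negqPoch m ≋ qPoch m *ₚ qbinom m m
central-binomial m = *-cancelˡ (qPoch m) (constOne-nonzero _ (pochₚ-constOne qₚ qₚ m refl)) (begin
  qPoch m *ₚ (P *ₚ negqPoch m)            ≈⟨ x∙yz≈y∙xz (qPoch m) P (negqPoch m) ⟩
  P *ₚ (qPoch m *ₚ negqPoch m)            ≈⟨ *-congˡ {P} (poch-neg qₚ qₚ m) ⟩
  P *ₚ pochₚ q² q² m                      ≈⟨ *-congˡ {P} (prodₚ-cong 1ₚ q² m (square qₚ)) ⟩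
  P *ₚ pochₚ (qₚ *ₚ qₚ) q² m              ≈⟨ poch-parity qₚ qₚ m ⟩
  qPoch (2 * m)                           ≡⟨ cong (λ k → qPoch (m + k)) (ℕP.+-identityʳ m) ⟩
  qPoch (m + m)                           ≈⟨ ≋-sym (qbinom-closed m m) ⟩
  (qPoch m *ₚ qPoch m) *ₚ qbinom m m      ≈⟨ *-assoc (qPoch m) (qPoch m) (qbinom m m) ⟩
  qPoch m *ₚ (qPoch m *ₚ qbinom m m)      ∎)
  where
  P = pochₚ qₚ q² m
  square : ∀ q → q *ₚ (q *ₚ 1ₚ) ≋ q *ₚ q
  square = solve-∀ Polyℤ

V U : ℕ → Poly
V m = negqPoch m ^ₚ 8 *ₚ qint (2 * m + 2)
U m = qbinom m m ^ₚ 4 *ₚ (1ₚ +ₚ qₚ)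

factorisation : ∀ m → sumNum m *ₚ V m ≋ qint (2 * m + 1) ^ₚ 3 *ₚ (U m *ₚ sumDen m)
factorisation m = begin
  (Q ^ₚ 3 *ₚ P) *ₚ (M ^ₚ 8 *ₚ J)                   ≈⟨ *-congʳ (*-congʳ (^-cong 3 (poch-q³ m))) ⟩
  ((P *ₚ N) ^ₚ 3 *ₚ P) *ₚ (M ^ₚ 8 *ₚ J)            ≈⟨ regroup P N M J ⟩
  N ^ₚ 3 *ₚ (((P *ₚ M) *ₚ M) ^ₚ 4 *ₚ J)            ≈⟨ *-congˡ {N ^ₚ 3} (*-congʳ (^-cong 4 PMM)) ⟩
  N ^ₚ 3 *ₚ ((G *ₚ R) ^ₚ 4 *ₚ J)                   ≈⟨ *-congˡ {N ^ₚ 3} (split G R J) ⟩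
  N ^ₚ 3 *ₚ (G ^ₚ 4 *ₚ (R ^ₚ 3 *ₚ (R *ₚ J)))       ≈⟨ *-congˡ {N ^ₚ 3} (*-congˡ {G ^ₚ 4} (*-congˡ {R ^ₚ 3} (≋-sym (poch-q⁴ m)))) ⟩
  N ^ₚ 3 *ₚ (G ^ₚ 4 *ₚ (R ^ₚ 3 *ₚ ((1ₚ +ₚ qₚ) *ₚ T))) ≈⟨ *-congˡ {N ^ₚ 3} (collect G R T (1ₚ +ₚ qₚ)) ⟩
  N ^ₚ 3 *ₚ ((G ^ₚ 4 *ₚ (1ₚ +ₚ qₚ)) *ₚ (R ^ₚ 3 *ₚ T)) ∎
  where
  P = pochₚ qₚ q² m
  Q = pochₚ q³ q² m
  R = pochₚ q² q² m
  T = pochₚ q⁴ q² m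
  M = negqPoch m
  G = qbinom m m
  N = qint (2 * m + 1)
  J = qint (2 * m + 2)
  PMM : (P *ₚ M) *ₚ M ≋ G *ₚ R
  PMM = begin
    (P *ₚ M) *ₚ M          ≈⟨ *-congʳ (central-binomial m) ⟩
    (qPoch m *ₚ G) *ₚ M    ≈⟨ xy∙z≈y∙xz (qPoch m) G M ⟩
    G *ₚ (qPoch m *ₚ M)    ≈⟨ *-congˡ {G} (poch-neg qₚ qₚ m) ⟩
    G *ₚ R                 ∎
  regroup : ∀ P N M J → ((P *ₚ N) ^ₚ 3 *ₚ P) *ₚ (M ^ₚ 8 *ₚ J) ≋ N ^ₚ 3 *ₚ (((P *ₚ M) *ₚ M) ^ₚ 4 *ₚ J)
  regroup P N M J = regroup′ P N M J
    where
    regroup′ : ∀ P N M J → (((P *ₚ N) *ₚ ((P *ₚ N) *ₚ ((P *ₚ N) *ₚ 1ₚ))) *ₚ P) *ₚ ((M *ₚ (M *ₚ (M *ₚ (M *ₚ (M *ₚ (M *ₚ (M *ₚ (M *ₚ 1ₚ)))))))) *ₚ J)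
                            ≋ (N *ₚ (N *ₚ (N *ₚ 1ₚ))) *ₚ ((((P *ₚ M) *ₚ M) *ₚ (((P *ₚ M) *ₚ M) *ₚ (((P *ₚ M) *ₚ M) *ₚ (((P *ₚ M) *ₚ M) *ₚ 1ₚ)))) *ₚ J)
    regroup′ = solve-∀ Polyℤ
  split : ∀ G R J → (G *ₚ R) ^ₚ 4 *ₚ J ≋ G ^ₚ 4 *ₚ (R ^ₚ 3 *ₚ (R *ₚ J))
  split G R J = split′ G R J
    where
    split′ : ∀ G R J → ((G *ₚ R) *ₚ ((G *ₚ R) *ₚ ((G *ₚ R) *ₚ ((G *ₚ R) *ₚ 1ₚ)))) *ₚ J ≋ (G *ₚ (G *ₚ (G *ₚ (G *ₚ 1ₚ)))) *ₚ ((R *ₚ (R *ₚ (R *ₚ 1ₚ))) *ₚ (R *ₚ J))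
    split′ = solve-∀ Polyℤ
  collect : ∀ G R T s → G ^ₚ 4 *ₚ (R ^ₚ 3 *ₚ (s *ₚ T)) ≋ (G ^ₚ 4 *ₚ s) *ₚ (R ^ₚ 3 *ₚ T)
  collect G R T s = collect′ G R T s
    where
    collect′ : ∀ G R T s → (G *ₚ (G *ₚ (G *ₚ (G *ₚ 1ₚ)))) *ₚ ((R *ₚ (R *ₚ (R *ₚ 1ₚ))) *ₚ (s *ₚ T)) ≋ ((G *ₚ (G *ₚ (G *ₚ (G *ₚ 1ₚ)))) *ₚ s) *ₚ ((R *ₚ (R *ₚ (R *ₚ 1ₚ))) *ₚ T)
    collect′ = solve-∀ Polyℤ

infix 4 _∣_[mod_]
record _∣_[mod_] (a c I : Poly) : Set where
  constructor divmod
  field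
    multiplier : Poly
    error      : Poly
    congruence : a *ₚ multiplier ≋ c +ₚ I *ₚ error

∣mod-resp : ∀ {a c c′ I} → c ≋ c′ → a ∣ c [mod I ] → a ∣ c′ [mod I ]
∣mod-resp c≋c′ (divmod W F e) = divmod W F (≋-trans e (+-congʳ c≋c′))

∣mod-one : ∀ I → 1ₚ ∣ 1ₚ [mod I ]
∣mod-one I = divmod 1ₚ 0ₚ (≋-trans (*-identityˡ 1ₚ) (≋-sym (≋-trans (+-congˡ {1ₚ} (zeroʳ I)) (+-identityʳ 1ₚ))))

∣mod-* : ∀ {a b c d I} → a ∣ c [mod I ] → b ∣ d [mod I ] → a *ₚ b ∣ c *ₚ d [mod I ]
∣mod-* {a} {b} {c} {d} {I} (divmod W F e) (divmod W′ F′ e′) =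
  divmod (W *ₚ W′) (F *ₚ d +ₚ c *ₚ F′ +ₚ I *ₚ (F *ₚ F′)) (begin
    (a *ₚ b) *ₚ (W *ₚ W′)                 ≈⟨ interchange a b W W′ ⟩
    (a *ₚ W) *ₚ (b *ₚ W′)                 ≈⟨ *-cong e e′ ⟩
    (c +ₚ I *ₚ F) *ₚ (d +ₚ I *ₚ F′)       ≈⟨ expand c d I F F′ ⟩
    c *ₚ d +ₚ I *ₚ (F *ₚ d +ₚ c *ₚ F′ +ₚ I *ₚ (F *ₚ F′)) ∎)
  where
  expand : ∀ c d I F F′ → (c +ₚ I *ₚ F) *ₚ (d +ₚ I *ₚ F′) ≋ c *ₚ d +ₚ I *ₚ (F *ₚ d +ₚ c *ₚ F′ +ₚ I *ₚ (F *ₚ F′))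
  expand = solve-∀ Polyℤ

∣mod-^ : ∀ {a c I} k → a ∣ c [mod I ] → a ^ₚ k ∣ c ^ₚ k [mod I ]
∣mod-^ {I = I} zero    d = ∣mod-one I
∣mod-^         (suc k) d = ∣mod-* d (∣mod-^ k d)

-- Lifting to the cube of the modulus: from a W = c + I F,
-- a W (c² - c I F + (I F)²) = c³ + I³ F³.
∣mod-cube : ∀ {a c I} → a ∣ c [mod I ] → a ∣ c ^ₚ 3 [mod I ^ₚ 3 ]
∣mod-cube {a} {c} {I} (divmod W F e) = divmod (W *ₚ Z) (F ^ₚ 3) (begin
  a *ₚ (W *ₚ Z)           ≈⟨ ≋-sym (*-assoc a W Z) ⟩
  (a *ₚ W) *ₚ Z           ≈⟨ *-congʳ e ⟩
  (c +ₚ I *ₚ F) *ₚ Z      ≈⟨ sum-of-cubes c I F ⟩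
  c ^ₚ 3 +ₚ I ^ₚ 3 *ₚ F ^ₚ 3 ∎)
  where
  Z = c *ₚ c -ₚ c *ₚ (I *ₚ F) +ₚ (I *ₚ F) *ₚ (I *ₚ F)
  sum-of-cubes : ∀ c I F → (c +ₚ I *ₚ F) *ₚ (c *ₚ c -ₚ c *ₚ (I *ₚ F) +ₚ (I *ₚ F) *ₚ (I *ₚ F))
                           ≋ c *ₚ (c *ₚ (c *ₚ 1ₚ)) +ₚ I *ₚ (I *ₚ (I *ₚ 1ₚ)) *ₚ (F *ₚ (F *ₚ (F *ₚ 1ₚ)))
  sum-of-cubes = solve-∀ Polyℤ

two : Poly
two = 1ₚ +ₚ 1ₚ

module OddModulus (m : ℕ) where
  n : ℕ
  n = 2 * m + 1

  N : Poly
  N = qint n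

  neg^odd : ∀ x → negₚ x ^ₚ n ≋ negₚ (x ^ₚ n)
  neg^odd x = begin
    negₚ x ^ₚ (2 * m + 1)          ≡⟨ cong (negₚ x ^ₚ_) (ℕP.+-comm (2 * m) 1) ⟩
    negₚ x *ₚ negₚ x ^ₚ (2 * m)    ≈⟨ *-congˡ {negₚ x} (^-* (negₚ x) 2 m) ⟩
    negₚ x *ₚ (negₚ x ^ₚ 2) ^ₚ m   ≈⟨ *-congˡ {negₚ x} (^-cong m (square-neg x)) ⟩
    negₚ x *ₚ (x ^ₚ 2) ^ₚ m        ≈⟨ *-congˡ {negₚ x} (≋-sym (^-* x 2 m)) ⟩
    negₚ x *ₚ x ^ₚ (2 * m)         ≈⟨ neg-out x (x ^ₚ (2 * m)) ⟩
    negₚ (x *ₚ x ^ₚ (2 * m))       ≡⟨ cong (λ k → negₚ (x ^ₚ k)) (ℕP.+-comm 1 (2 * m)) ⟩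
    negₚ (x ^ₚ (2 * m + 1))        ∎
    where
    square-neg : ∀ x → negₚ x *ₚ (negₚ x *ₚ 1ₚ) ≋ x *ₚ (x *ₚ 1ₚ)
    square-neg = solve-∀ Polyℤ
    neg-out : ∀ x y → negₚ x *ₚ y ≋ negₚ (x *ₚ y)
    neg-out = solve-∀ Polyℤ

  q^multiple : ∀ k → 1ₚ -ₚ (qₚ ^ₚ n) ^ₚ k ≋ N *ₚ ((1ₚ -ₚ qₚ) *ₚ geom (qₚ ^ₚ n) k)
  q^multiple k = begin
    1ₚ -ₚ (qₚ ^ₚ n) ^ₚ k                       ≈⟨ ≋-sym (geom-closed (qₚ ^ₚ n) k) ⟩
    (1ₚ -ₚ qₚ ^ₚ n) *ₚ g                       ≈⟨ *-congʳ (≋-sym (qint-closed n)) ⟩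
    ((1ₚ -ₚ qₚ) *ₚ N) *ₚ g                     ≈⟨ xy∙z≈y∙xz (1ₚ -ₚ qₚ) N g ⟩
    N *ₚ ((1ₚ -ₚ qₚ) *ₚ g)                     ∎
    where
    g = geom (qₚ ^ₚ n) k

  -- 1 + q^{j+1} divides 2 modulo [n]: (1 + x) Σ_{i<n} (-x)^i = 1 + x^n ≡ 2.
  factor∣two : ∀ j → 1ₚ -ₚ negₚ qₚ *ₚ qₚ ^ₚ j ∣ two [mod N ]
  factor∣two j = divmod (geom (negₚ x) n) (negₚ ((1ₚ -ₚ qₚ) *ₚ geom (qₚ ^ₚ n) (suc j))) (begin
    (1ₚ -ₚ negₚ qₚ *ₚ qₚ ^ₚ j) *ₚ geom (negₚ x) n     ≈⟨ *-congʳ (neg-assoc qₚ (qₚ ^ₚ j)) ⟩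
    (1ₚ -ₚ negₚ x) *ₚ geom (negₚ x) n                  ≈⟨ geom-closed (negₚ x) n ⟩
    1ₚ -ₚ negₚ x ^ₚ n                                  ≈⟨ +-congˡ {1ₚ} (-‿cong (neg^odd x)) ⟩
    1ₚ -ₚ negₚ (x ^ₚ n)                                ≈⟨ +-congˡ {1ₚ} (-‿cong (-‿cong x^n)) ⟩
    1ₚ -ₚ negₚ ((qₚ ^ₚ n) ^ₚ suc j)                    ≈⟨ rearrange ((qₚ ^ₚ n) ^ₚ suc j) ⟩
    two -ₚ (1ₚ -ₚ (qₚ ^ₚ n) ^ₚ suc j)                  ≈⟨ +-congˡ {two} (-‿cong (q^multiple (suc j))) ⟩
    two -ₚ N *ₚ ((1ₚ -ₚ qₚ) *ₚ geom (qₚ ^ₚ n) (suc j)) ≈⟨ neg-inside two N ((1ₚ -ₚ qₚ) *ₚ geom (qₚ ^ₚ n) (suc j)) ⟩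
    two +ₚ N *ₚ negₚ ((1ₚ -ₚ qₚ) *ₚ geom (qₚ ^ₚ n) (suc j)) ∎)
    where
    x = qₚ ^ₚ suc j
    x^n : x ^ₚ n ≋ (qₚ ^ₚ n) ^ₚ suc j
    x^n = ≋-trans (≋-sym (^-* qₚ (suc j) n))
                  (≋-trans (≋-reflexive (cong (qₚ ^ₚ_) (ℕP.*-comm (suc j) n))) (^-* qₚ n (suc j)))
    neg-assoc : ∀ q y → 1ₚ -ₚ negₚ q *ₚ y ≋ 1ₚ -ₚ negₚ (q *ₚ y)
    neg-assoc = solve-∀ Polyℤ
    rearrange : ∀ z → 1ₚ -ₚ negₚ z ≋ (1ₚ +ₚ 1ₚ) -ₚ (1ₚ -ₚ z)
    rearrange = solve-∀ Polyℤ
    neg-inside : ∀ t N G → t -ₚ N *ₚ G ≋ t +ₚ N *ₚ negₚ G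
    neg-inside = solve-∀ Polyℤ

  negqPoch∣two^ : ∀ k → negqPoch k ∣ two ^ₚ k [mod N ]
  negqPoch∣two^ zero    = ∣mod-one N
  negqPoch∣two^ (suc k) = ∣mod-resp (*-comm (two ^ₚ k) two) (∣mod-* (negqPoch∣two^ k) (factor∣two k))

  -- [n+1] = 1 + q [n] ≡ 1
  qint-next∣one : qint (2 * m + 2) ∣ 1ₚ [mod N ]
  qint-next∣one = divmod 1ₚ qₚ (≋-trans (*-identityʳ _)
    (≋-trans (≋-reflexive (cong qint (ℕP.+-suc (2 * m) 1))) (+-congˡ {1ₚ} (*-comm qₚ N))))

  V∣two^ : V m ∣ two ^ₚ (m * 8 * 3) [mod N ^ₚ 3 ]
  V∣two^ = ∣mod-resp power (∣mod-cube (∣mod-* (∣mod-^ 8 (negqPoch∣two^ m)) qint-next∣one))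
    where
    power : ((two ^ₚ m) ^ₚ 8 *ₚ 1ₚ) ^ₚ 3 ≋ two ^ₚ (m * 8 * 3)
    power = ≋-trans (^-cong 3 (≋-trans (*-identityʳ _) (≋-sym (^-* two m 8)))) (≋-sym (^-* two (m * 8) 3))

-- Cancelling a nonzero integer factor d against a polynomial f with constant
-- term 1: if f T = d X then d divides every coefficient of T (induction from the
-- constant term), hence f divides X.

Multiple : ℤ → ℤ → Set
Multiple d x = Σ ℤ λ s → x ≡ d ℤ.* s

coefficients-multiple : ∀ f d → ConstOne f → ∀ T → (∀ i → Multiple d (coeff (f *ₚ T) i)) →
                        Σ Poly λ T′ → T ≋ d ·ₚ T′
coefficients-multiple f d f₀ []      mult = [] , ≋-refl
coefficients-multiple f d f₀ (t ∷ T) mult = (s ∷ proj₁ rest) , cons-cong t≡ds (proj₂ rest)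
  where
  -- f (t ∷ T) = t f + q (f T): its constant term is t, its (i+1)-st is t f_{i+1} + (f T)_i
  low : ∀ i → coeff (f *ₚ (t ∷ T)) i ≡ t ℤ.* coeff f i ℤ.+ coeff (sh (f *ₚ T)) i
  low i = ≡.trans (get (*-cons f t T) i)
                  (≡.trans (coeff-+ (t ·ₚ f) (sh (f *ₚ T)) i) (cong (ℤ._+ coeff (sh (f *ₚ T)) i) (coeff-· t f i)))
  s : ℤ
  s = proj₁ (mult 0)
  t≡ds : t ≡ d ℤ.* s
  t≡ds = ≡.trans (≡.sym (≡.trans (low 0) (≡.trans (cong (λ c → t ℤ.* c ℤ.+ + 0) f₀) (unit t))))
                 (proj₂ (mult 0))
    where
    unit : ∀ t → t ℤ.* + 1 ℤ.+ + 0 ≡ t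
    unit = ℤSolver.solve-∀
  shift : ∀ d s c u w → (d ℤ.* s) ℤ.* c ℤ.+ u ≡ d ℤ.* w → u ≡ d ℤ.* (w ℤ.- s ℤ.* c)
  shift d s c u w e = ≡.trans (isolate (d ℤ.* s ℤ.* c) u) (≡.trans (cong (ℤ._- d ℤ.* s ℤ.* c) e) (factor d s c w))
    where
    isolate : ∀ a u → u ≡ (a ℤ.+ u) ℤ.- a
    isolate = ℤSolver.solve-∀
    factor : ∀ d s c w → d ℤ.* w ℤ.- d ℤ.* s ℤ.* c ≡ d ℤ.* (w ℤ.- s ℤ.* c)
    factor = ℤSolver.solve-∀
  tail-multiple : ∀ i → Multiple d (coeff (f *ₚ T) i)
  tail-multiple i = (w ℤ.- s ℤ.* coeff f (suc i)) ,
    shift d s (coeff f (suc i)) (coeff (f *ₚ T) i) w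
          (≡.trans (≡.sym (≡.trans (low (suc i)) (cong (λ a → a ℤ.* coeff f (suc i) ℤ.+ coeff (f *ₚ T) i) t≡ds)))
                   (proj₂ (mult (suc i))))
    where
    w = proj₁ (mult (suc i))
  rest = coefficients-multiple f d f₀ T tail-multiple

constant-* : ∀ d p → (d ∷ []) *ₚ p ≋ d ·ₚ p
constant-* d p = ≋-trans (+-congˡ {d ·ₚ p} (mk λ { zero → refl ; (suc i) → refl })) (+-identityʳ (d ·ₚ p))

cancel-constant : ∀ f d → ConstOne f → d ≢ + 0 → ∀ T X → f *ₚ T ≋ (d ∷ []) *ₚ X → f ∣ₚ X
cancel-constant f d f₀ d≢0 T X e = T′ , get (≋-sym (*-cancelˡ (d ∷ []) (coeff₀-nonzero _ d≢0) (begin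
  (d ∷ []) *ₚ (f *ₚ T′)   ≈⟨ x∙yz≈y∙xz (d ∷ []) f T′ ⟩
  f *ₚ ((d ∷ []) *ₚ T′)   ≈⟨ *-congˡ {f} (≋-trans (constant-* d T′) (≋-sym T≋dT′)) ⟩
  f *ₚ T                  ≈⟨ e ⟩
  (d ∷ []) *ₚ X           ∎)))
  where
  multiple : ∀ i → Multiple d (coeff (f *ₚ T) i)
  multiple i = coeff X i , ≡.trans (get (≋-trans e (constant-* d X)) i) (coeff-· d X i)
  T′ = proj₁ (coefficients-multiple f d f₀ T multiple)
  T≋dT′ = proj₂ (coefficients-multiple f d f₀ T multiple)

cancel-constant^ : ∀ f d K → ConstOne f → d ≢ + 0 → ∀ T X → f *ₚ T ≋ (d ∷ []) ^ₚ K *ₚ X → f ∣ₚ X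
cancel-constant^ f d zero    f₀ d≢0 T X e = T , get (≋-sym (≋-trans e (*-identityˡ X)))
cancel-constant^ f d (suc K) f₀ d≢0 T X e =
  cancel-constant^ f d K f₀ d≢0 (proj₁ peeled) X (≋-sym (mk (proj₂ peeled)))
  where
  peeled : f ∣ₚ (d ∷ []) ^ₚ K *ₚ X
  peeled = cancel-constant f d f₀ d≢0 T _ (≋-trans e (*-assoc (d ∷ []) ((d ∷ []) ^ₚ K) X))

transfer : ∀ {a c d e} i u v → Nonzero e → a *ₚ e ≋ c *ₚ d → c *ₚ v ≋ i *ₚ (u *ₚ e) → a *ₚ v ≋ i *ₚ (u *ₚ d)
transfer {a} {c} {d} {e} i u v ne cross fact = *-cancelˡ e ne (begin
  e *ₚ (a *ₚ v)          ≈⟨ x∙yz≈yx∙z e a v ⟩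
  (a *ₚ e) *ₚ v          ≈⟨ *-congʳ cross ⟩
  (c *ₚ d) *ₚ v          ≈⟨ xy∙z≈xz∙y c d v ⟩
  (c *ₚ v) *ₚ d          ≈⟨ *-congʳ fact ⟩
  (i *ₚ (u *ₚ e)) *ₚ d   ≈⟨ rearrange i u e d ⟩
  e *ₚ (i *ₚ (u *ₚ d))   ∎)
  where
  rearrange : ∀ i u e d → (i *ₚ (u *ₚ e)) *ₚ d ≋ e *ₚ (i *ₚ (u *ₚ d))
  rearrange = solve-∀ Polyℤ

multiple-mod : ∀ {a v i g c} → a *ₚ v ≋ i *ₚ g → v ∣ c [mod i ] → Σ Poly λ T → i *ₚ T ≋ c *ₚ a
multiple-mod {a} {v} {i} {g} {c} av (divmod w f vw) = g *ₚ w -ₚ f *ₚ a , (begin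
  i *ₚ (g *ₚ w -ₚ f *ₚ a)           ≈⟨ distribute i g w f a ⟩
  (i *ₚ g) *ₚ w -ₚ i *ₚ (f *ₚ a)    ≈⟨ +-congʳ (*-congʳ (≋-sym av)) ⟩
  (a *ₚ v) *ₚ w -ₚ i *ₚ (f *ₚ a)    ≈⟨ reassociate a v w i f ⟩
  (v *ₚ w) *ₚ a -ₚ i *ₚ (f *ₚ a)    ≈⟨ +-congʳ (*-congʳ vw) ⟩
  (c +ₚ i *ₚ f) *ₚ a -ₚ i *ₚ (f *ₚ a) ≈⟨ cancel c i f a ⟩
  c *ₚ a                            ∎)
  where
  distribute : ∀ i g w f a → i *ₚ (g *ₚ w -ₚ f *ₚ a) ≋ (i *ₚ g) *ₚ w -ₚ i *ₚ (f *ₚ a)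
  distribute = solve-∀ Polyℤ
  reassociate : ∀ a v w i f → (a *ₚ v) *ₚ w -ₚ i *ₚ (f *ₚ a) ≋ (v *ₚ w) *ₚ a -ₚ i *ₚ (f *ₚ a)
  reassociate = solve-∀ Polyℤ
  cancel : ∀ c i f a → (c +ₚ i *ₚ f) *ₚ a -ₚ i *ₚ (f *ₚ a) ≋ c *ₚ a
  cancel = solve-∀ Polyℤ

theorem5p9 : (n m : ℕ) → n ≡ 2 * m + 1 → 1 < n →
    sumf summand m ≡0-mod (qint n ^ₚ 3)
theorem5p9 .(2 * m + 1) m refl _ Num Den (Den≢0 , _ , Num/Den≡S) =
  cancel-constant^ (N ^ₚ 3) (+ 2) (m * 8 * 3) (constOne-^ N 3 N₀) (λ ()) _ Num (proj₂ cleared)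
  where
  open OddModulus m using (N; V∣two^)
  N₀ : ConstOne N
  N₀ = ≡.subst (λ k → ConstOne (qint k)) (ℕP.+-comm 1 (2 * m)) (qint-constOne (2 * m))
  same-fraction : Num *ₚ sumDen m ≋ sumNum m *ₚ Den
  same-fraction = ≋-sym (rep-cross (partialSum-rep m) Num/Den)
    where
    Num/Den : Rep (sumf summand m) Num Den
    Num/Den = rep (≋-sym (mk Num/Den≡S)) (den-nonzero (partialSum-rep m)) (λ e → Den≢0 (get e))
  NumV : Num *ₚ V m ≋ N ^ₚ 3 *ₚ (U m *ₚ Den)
  NumV = transfer {Num} {sumNum m} (N ^ₚ 3) (U m) (V m) (constOne-nonzero _ (sumDen-constOne m))
                  same-fraction (factorisation m)
  -- [n]³ T = 2^K Num; since [n]³ has constant term 1, the factor 2^K cancels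
  cleared : Σ Poly λ T → N ^ₚ 3 *ₚ T ≋ two ^ₚ (m * 8 * 3) *ₚ Num
  cleared = multiple-mod NumV V∣two^
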